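{- Let $m\geq 2$ and $n\geq 1$ be integers. Let $\{i_1,i_2,\ldots,i_t\}$ be a nonempty proper subset of $\{m-1,m,\ldots,m+n-2\}$ with $i_1<i_2<\cdots<i_t$. If $0\leq k\leq 2^{m-2}-2$, then $$T\Big(c^k\prod_{j=1}^t a_{i_j},\;a_{m+n-1}+a_{m-1}\Big)=0.$$
   Context: $a_i=a_i(c)\in\mathbb{Z}[c]$ is defined by $a_0=0$ and $a_i=a_{i-1}^2+c$ for $i\geq1$ (the iterates $f_c^i(0)$ of $f_c(z)=z^2+c$). For polynomials $f,g$ over a field with $g\neq 0$, $T(f,g)$ is the sum of $f(\gamma)$ over all roots $\gamma$ of $g$ (in an algebraic closure), counted with multiplicity. -}

module Defs where

open import Level using (_⊔_)
open import Data.Nat using (ℕ; zero; suc)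
open import Data.List using (List; []; _∷_)
open import Data.Product using (Σ; ∃; _×_)
open import Relation.Nullary using (¬_)
open import Relation.Binary.PropositionalEquality using (_≡_)
open import Algebra.Bundles using (CommutativeRing)

module _ {c ℓ} (R : CommutativeRing c ℓ) where
  open CommutativeRing R

  IsField : Set (c ⊔ ℓ)
  IsField = (¬ (1# ≈ 0#)) × (∀ x → ¬ (x ≈ 0#) → ∃ λ y → x * y ≈ 1#)

  IsInfinite : Set (c ⊔ ℓ)
  IsInfinite = Σ (ℕ → Carrier) λ f → ∀ i j → f i ≈ f j → i ≡ j

  pow : Carrier → ℕ → Carrier
  pow x zero    = 1#
  pow x (suc k) = x * pow x k

  -- a_i(c) = f_c^i(0):  a_0 = 0, a_i = a_{i-1}^2 + c
  a : ℕ → Carrier → Carrier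
  a zero    x = 0#
  a (suc i) x = a i x * a i x + x

  sumL : List Carrier → Carrier
  sumL []       = 0#
  sumL (x ∷ xs) = x + sumL xs

  prodL : List Carrier → Carrier
  prodL []       = 1#
  prodL (x ∷ xs) = x * prodL xs

  linProd : List Carrier → Carrier → Carrier
  linProd []       x = 1#
  linProd (γ ∷ γs) x = (x - γ) * linProd γs x

  mapL : ∀ {b} {B : Set b} → (B → Carrier) → List B → List Carrier
  mapL f []       = []
  mapL f (y ∷ ys) = f y ∷ mapL f ys

  -- γs is the list of all roots of the monic polynomial function g, with multiplicity:
  -- g(x) = ∏ (x - γ) for all x.  (Over an infinite field this is equality of polynomials.)
  IsRootList : (Carrier → Carrier) → List Carrier → Set (c ⊔ ℓ)
  IsRootList g γs = ∀ x → g x ≈ linProd γs x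

  -- T(f, g) computed from a root list of g
  Tsum : (Carrier → Carrier) → List Carrier → Carrier
  Tsum f γs = sumL (mapL f γs)

-- Work with reversed polynomials: for deg f ≤ d let ρ(X) = X^d f(1/X).  If the γ are the roots
-- of g = a_(m+n-1) + a_(m-1), then Σ_γ f(γ) is the coefficient of X^d in ρ E, where
-- E = Σ_γ 1/(1 - γX), and Newton's identity reads Π E = L Π - X Π′ for the reversal
-- Π = ∏ (1 - γX) of g.  The reversal r_j of a_(j+1) satisfies r_(j+1) = r_j² + X^(2^(j+1) - 1),
-- so modulo X^(d+1) we have Π ≡ r_(m+n-2) and r_(j+1) ≡ r_j² as long as 2^(j+1) > d + 1; the
-- bound on k and the index missing from {i_1, …, i_t} keep d = k + Σ 2^(i_j - 1) that small.
-- Cancelling r_j from the squares carries Newton's identity down to r E ≡ L r - n X r′ for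
-- r = r_(i_t - 1), whose right-hand side has degree < 2^(i_t - 1).  Since ρ = V r with
-- deg V = d - 2^(i_t - 1), the coefficient of X^d in ρ E = V (r E) vanishes.

module Submission where

open import Algebra.Bundles using (CommutativeRing)
import Algebra.Construct.Pointwise as Pointwise
open import Algebra.Morphism.Structures using (IsRingMonomorphism)
import Algebra.Morphism.RingMonomorphism as RingMonomorphism
open import Algebra.Solver.Ring.AlmostCommutativeRing using (fromCommutativeRing; _-Raw-AlmostCommutative⟶_)
open import Data.Empty using (⊥-elim)
open import Data.Integer as ℤ using (ℤ; +_; -[1+_]; _⊖_; _◃_)
import Data.Integer.Properties as ℤ
open import Data.List using (List; []; _∷_; _++_; _∷ʳ_; length; map; initLast; _∷ʳ′_)
open import Data.List.Properties using (map-++)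
open import Data.List.Membership.Propositional using (_∉_)
open import Data.List.Relation.Unary.All as All using (All)
open import Data.List.Relation.Unary.All.Properties using (∷ʳ⁻)
open import Data.List.Relation.Unary.Linked using (Linked)
open import Data.List.Relation.Unary.Linked.Properties using (Linked⇒AllPairs)
open import Data.Maybe using (Maybe; just; nothing)
open import Data.Nat as ℕ using (ℕ; zero; suc; z≤n; s≤s; _∸_; _≤_; _<_; _^_)
open import Data.Nat.ListAction using (sum)
open import Data.Nat.ListAction.Properties using (sum-++)
import Data.Nat.Properties as ℕ
open import Data.Product using (∃; _×_; _,_; proj₁; proj₂)
open import Data.Sign as Sign using ()
open import Function using (_∘_)
open import Relation.Binary.Bundles using (Setoid)
open import Relation.Binary.Definitions using (tri<; tri≈; tri>)
open import Relation.Binary.PropositionalEquality as ≡ using (_≡_; _≢_)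
import Relation.Binary.Reasoning.Setoid
open import Relation.Binary.Structures using (IsEquivalence)
open import Relation.Nullary using (¬_; yes; no)

open import Defs


-- The ring solver needs coefficients with decidable equality, so we use ℤ, which maps into any
-- commutative ring.  With the left-associated multiple _×′_ (here _·_), con (+ 1) is 1# itself.
module ℤ-RingSolver {c ℓ} (R : CommutativeRing c ℓ) where
  open CommutativeRing R
  open import Algebra.Properties.Ring ring using (-0#≈0#; -‿involutive; -‿+-comm; -‿distribˡ-*; -‿distribʳ-*)
  open import Algebra.Properties.CommutativeSemigroup +-commutativeSemigroup using (interchange)
  open import Algebra.Properties.Semiring.Mult.TCOptimised semiring using (×-homo-+; ×1-homo-*; ×-cong; 1+×) renaming (_×_ to _·_)
  open import Relation.Binary.Reasoning.Setoid setoid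

  ⟦_⟧ℤ : ℤ → Carrier
  ⟦ + n ⟧ℤ      = n · 1#
  ⟦ -[1+ n ] ⟧ℤ = - (suc n · 1#)

  -‿homo : ∀ i → ⟦ ℤ.- i ⟧ℤ ≈ - ⟦ i ⟧ℤ
  -‿homo (+ zero)   = sym -0#≈0#
  -‿homo (+ suc n)  = refl
  -‿homo -[1+ n ]   = sym (-‿involutive _)

  ⊖-homo : ∀ m n → ⟦ m ⊖ n ⟧ℤ ≈ m · 1# - n · 1#
  ⊖-homo m       zero    = sym (trans (+-congˡ -0#≈0#) (+-identityʳ _))
  ⊖-homo zero    (suc n) = sym (+-identityˡ _)
  ⊖-homo (suc m) (suc n) = begin
    ⟦ suc m ⊖ suc n ⟧ℤ                  ≡⟨ ≡.cong ⟦_⟧ℤ (ℤ.[1+m]⊖[1+n]≡m⊖n m n) ⟩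
    ⟦ m ⊖ n ⟧ℤ                          ≈⟨ ⊖-homo m n ⟩
    m · 1# - n · 1#                     ≈⟨ +-identityˡ _ ⟨
    0# + (m · 1# - n · 1#)              ≈⟨ +-congʳ (-‿inverseʳ 1#) ⟨
    (1# - 1#) + (m · 1# - n · 1#)       ≈⟨ interchange 1# (- 1#) (m · 1#) (- (n · 1#)) ⟩
    (1# + m · 1#) + (- 1# - n · 1#)     ≈⟨ +-congˡ (-‿+-comm 1# (n · 1#)) ⟩
    (1# + m · 1#) - (1# + n · 1#)       ≈⟨ +-cong (1+× m 1#) (-‿cong (1+× n 1#)) ⟨
    suc m · 1# - suc n · 1#             ∎

  +-homo : ∀ i j → ⟦ i ℤ.+ j ⟧ℤ ≈ ⟦ i ⟧ℤ + ⟦ j ⟧ℤ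
  +-homo (+ m)    (+ n)    = ×-homo-+ 1# m n
  +-homo (+ m)    -[1+ n ] = ⊖-homo m (suc n)
  +-homo -[1+ m ] (+ n)    = trans (⊖-homo n (suc m)) (+-comm _ _)
  +-homo -[1+ m ] -[1+ n ] = begin
    - (suc (suc (m ℕ.+ n)) · 1#)        ≈⟨ -‿cong (×-cong (≡.cong suc (≡.sym (ℕ.+-suc m n))) refl) ⟩
    - ((suc m ℕ.+ suc n) · 1#)          ≈⟨ -‿cong (×-homo-+ 1# (suc m) (suc n)) ⟩
    - (suc m · 1# + suc n · 1#)         ≈⟨ -‿+-comm _ _ ⟨
    - (suc m · 1#) - suc n · 1#         ∎

  *-homo : ∀ i j → ⟦ i ℤ.* j ⟧ℤ ≈ ⟦ i ⟧ℤ * ⟦ j ⟧ℤ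
  *-homo (+ m) (+ n) = begin
    ⟦ Sign.+ ◃ m ℕ.* n ⟧ℤ   ≡⟨ ≡.cong ⟦_⟧ℤ (ℤ.+◃n≡+n (m ℕ.* n)) ⟩
    (m ℕ.* n) · 1#          ≈⟨ ×1-homo-* m n ⟩
    m · 1# * n · 1#         ∎
  *-homo (+ m) -[1+ n ] = begin
    ⟦ Sign.- ◃ m ℕ.* suc n ⟧ℤ   ≡⟨ ≡.cong ⟦_⟧ℤ (ℤ.-◃n≡-n (m ℕ.* suc n)) ⟩
    ⟦ ℤ.- + (m ℕ.* suc n) ⟧ℤ    ≈⟨ -‿homo (+ (m ℕ.* suc n)) ⟩
    - ((m ℕ.* suc n) · 1#)      ≈⟨ -‿cong (×1-homo-* m (suc n)) ⟩
    - (m · 1# * suc n · 1#)     ≈⟨ -‿distribʳ-* _ _ ⟩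
    m · 1# * - (suc n · 1#)     ∎
  *-homo -[1+ m ] (+ n) = begin
    ⟦ Sign.- ◃ suc m ℕ.* n ⟧ℤ   ≡⟨ ≡.cong ⟦_⟧ℤ (ℤ.-◃n≡-n (suc m ℕ.* n)) ⟩
    ⟦ ℤ.- + (suc m ℕ.* n) ⟧ℤ    ≈⟨ -‿homo (+ (suc m ℕ.* n)) ⟩
    - ((suc m ℕ.* n) · 1#)      ≈⟨ -‿cong (×1-homo-* (suc m) n) ⟩
    - (suc m · 1# * n · 1#)     ≈⟨ -‿distribˡ-* _ _ ⟩
    - (suc m · 1#) * n · 1#     ∎
  *-homo -[1+ m ] -[1+ n ] = begin
    (suc m ℕ.* suc n) · 1#            ≈⟨ ×1-homo-* (suc m) (suc n) ⟩
    suc m · 1# * suc n · 1#           ≈⟨ -‿involutive _ ⟨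
    - - (suc m · 1# * suc n · 1#)     ≈⟨ -‿cong (-‿distribˡ-* _ _) ⟩
    - (- (suc m · 1#) * suc n · 1#)   ≈⟨ -‿distribʳ-* _ _ ⟩
    - (suc m · 1#) * - (suc n · 1#)   ∎

  ℤ⟶R : ℤ.+-*-rawRing -Raw-AlmostCommutative⟶ fromCommutativeRing R
  ℤ⟶R = record
    { ⟦_⟧ = ⟦_⟧ℤ ; +-homo = +-homo ; *-homo = *-homo ; -‿homo = -‿homo
    ; 0-homo = refl ; 1-homo = refl }

  ⟦⟧ℤ-≟ : ∀ i j → Maybe (⟦ i ⟧ℤ ≈ ⟦ j ⟧ℤ)
  ⟦⟧ℤ-≟ i j with i ℤ.≟ j
  ... | yes ≡.refl = just refl
  ... | no _       = nothing

  open import Algebra.Solver.Ring ℤ.+-*-rawRing (fromCommutativeRing R) ℤ⟶R ⟦⟧ℤ-≟ public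


module Polynomial {c ℓ} (K : CommutativeRing c ℓ) where
  open CommutativeRing K
  open import Algebra.Properties.Ring ring using (-0#≈0#)
  open import Relation.Binary.Reasoning.Setoid setoid
  open ℤ-RingSolver K using (solve; _:+_; _:*_; _:-_; :-_; _:=_; con)

  Poly : Set c
  Poly = List Carrier

  coeff : Poly → ℕ → Carrier
  coeff []      j       = 0#
  coeff (a ∷ p) zero    = a
  coeff (a ∷ p) (suc j) = coeff p j

  infix 4 _≈ᴾ_
  record _≈ᴾ_ (p q : Poly) : Set ℓ where
    constructor mk≈ᴾ
    field coeff-≈ : ∀ j → coeff p j ≈ coeff q j
  open _≈ᴾ_ public

  eval : Poly → Carrier → Carrier
  eval []      x = 0#
  eval (a ∷ p) x = a + x * eval p x

  infixl 6 _+ᴾ_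
  infixl 7 _*ᴾ_
  infix  8 -ᴾ_

  _+ᴾ_ : Poly → Poly → Poly
  []      +ᴾ q       = q
  (a ∷ p) +ᴾ []      = a ∷ p
  (a ∷ p) +ᴾ (b ∷ q) = (a + b) ∷ (p +ᴾ q)

  scale : Carrier → Poly → Poly
  scale a = map (a *_)

  -ᴾ_ : Poly → Poly
  -ᴾ_ = map (-_)

  _*ᴾ_ : Poly → Poly → Poly
  []      *ᴾ q = []
  (a ∷ p) *ᴾ q = scale a q +ᴾ (0# ∷ p *ᴾ q)

  1ᴾ : Poly
  1ᴾ = 1# ∷ []

  coeff-+ᴾ : ∀ p q j → coeff (p +ᴾ q) j ≈ coeff p j + coeff q j
  coeff-+ᴾ []      q       j       = sym (+-identityˡ _)
  coeff-+ᴾ (a ∷ p) []      j       = sym (+-identityʳ _)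
  coeff-+ᴾ (a ∷ p) (b ∷ q) zero    = refl
  coeff-+ᴾ (a ∷ p) (b ∷ q) (suc j) = coeff-+ᴾ p q j

  coeff-scale : ∀ a p j → coeff (scale a p) j ≈ a * coeff p j
  coeff-scale a []      j       = sym (zeroʳ a)
  coeff-scale a (b ∷ p) zero    = refl
  coeff-scale a (b ∷ p) (suc j) = coeff-scale a p j

  coeff--ᴾ : ∀ p j → coeff (-ᴾ p) j ≈ - coeff p j
  coeff--ᴾ []      j       = sym -0#≈0#
  coeff--ᴾ (b ∷ p) zero    = refl
  coeff--ᴾ (b ∷ p) (suc j) = coeff--ᴾ p j

  eval-+ᴾ : ∀ p q x → eval (p +ᴾ q) x ≈ eval p x + eval q x
  eval-+ᴾ []      q       x = sym (+-identityˡ _)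
  eval-+ᴾ (a ∷ p) []      x = sym (+-identityʳ _)
  eval-+ᴾ (a ∷ p) (b ∷ q) x = begin
    (a + b) + x * eval (p +ᴾ q) x
      ≈⟨ +-congˡ (*-congˡ (eval-+ᴾ p q x)) ⟩
    (a + b) + x * (eval p x + eval q x)
      ≈⟨ solve 5 (λ a b x u v → (a :+ b) :+ x :* (u :+ v) := (a :+ x :* u) :+ (b :+ x :* v)) refl a b x (eval p x) (eval q x) ⟩
    (a + x * eval p x) + (b + x * eval q x)  ∎

  eval-scale : ∀ a p x → eval (scale a p) x ≈ a * eval p x
  eval-scale a []      x = sym (zeroʳ a)
  eval-scale a (b ∷ p) x = begin
    a * b + x * eval (scale a p) x   ≈⟨ +-congˡ (*-congˡ (eval-scale a p x)) ⟩
    a * b + x * (a * eval p x)       ≈⟨ solve 4 (λ a b x u → a :* b :+ x :* (a :* u) := a :* (b :+ x :* u)) refl a b x (eval p x) ⟩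
    a * (b + x * eval p x)           ∎

  eval--ᴾ : ∀ p x → eval (-ᴾ p) x ≈ - eval p x
  eval--ᴾ []      x = sym -0#≈0#
  eval--ᴾ (b ∷ p) x = begin
    - b + x * eval (-ᴾ p) x   ≈⟨ +-congˡ (*-congˡ (eval--ᴾ p x)) ⟩
    - b + x * - eval p x      ≈⟨ solve 3 (λ b x u → :- b :+ x :* (:- u) := :- (b :+ x :* u)) refl b x (eval p x) ⟩
    - (b + x * eval p x)      ∎

  eval-*ᴾ : ∀ p q x → eval (p *ᴾ q) x ≈ eval p x * eval q x
  eval-*ᴾ []      q x = sym (zeroˡ _)
  eval-*ᴾ (a ∷ p) q x = begin
    eval (scale a q +ᴾ (0# ∷ p *ᴾ q)) x
      ≈⟨ eval-+ᴾ (scale a q) (0# ∷ p *ᴾ q) x ⟩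
    eval (scale a q) x + (0# + x * eval (p *ᴾ q) x)
      ≈⟨ +-cong (eval-scale a q x) (+-congˡ (*-congˡ (eval-*ᴾ p q x))) ⟩
    a * eval q x + (0# + x * (eval p x * eval q x))
      ≈⟨ solve 4 (λ a x u v → a :* v :+ (con (+ 0) :+ x :* (u :* v)) := (a :+ x :* u) :* v) refl a x (eval p x) (eval q x) ⟩
    (a + x * eval p x) * eval q x  ∎

  coeff≈0⇒eval≈0 : ∀ p → (∀ j → coeff p j ≈ 0#) → ∀ x → eval p x ≈ 0#
  coeff≈0⇒eval≈0 []      p≈0 x = refl
  coeff≈0⇒eval≈0 (a ∷ p) p≈0 x = begin
    a + x * eval p x   ≈⟨ +-cong (p≈0 0) (*-congˡ (coeff≈0⇒eval≈0 p (p≈0 ∘ suc) x)) ⟩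
    0# + x * 0#        ≈⟨ solve 1 (λ x → con (+ 0) :+ x :* con (+ 0) := con (+ 0)) refl x ⟩
    0#                 ∎

  eval-cong : ∀ {p q} → p ≈ᴾ q → ∀ x → eval p x ≈ eval q x
  eval-cong {[]}    {q}     p≈q x = sym (coeff≈0⇒eval≈0 q (λ j → sym (coeff-≈ p≈q j)) x)
  eval-cong {a ∷ p} {[]}    p≈q x = coeff≈0⇒eval≈0 (a ∷ p) (coeff-≈ p≈q) x
  eval-cong {a ∷ p} {b ∷ q} p≈q x =
    +-cong (coeff-≈ p≈q 0) (*-congˡ (eval-cong {p} {q} (mk≈ᴾ (coeff-≈ p≈q ∘ suc)) x))

  quotient : Carrier → Poly → Poly
  quotient z []          = []
  quotient z (a ∷ [])    = []
  quotient z (a ∷ b ∷ p) = eval (b ∷ p) z ∷ quotient z (b ∷ p)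

  eval-quotient : ∀ z p x → eval p x ≈ (x - z) * eval (quotient z p) x + eval p z
  eval-quotient z []          x = solve 2 (λ x z → con (+ 0) := (x :- z) :* con (+ 0) :+ con (+ 0)) refl x z
  eval-quotient z (a ∷ [])    x = solve 3 (λ a x z → a :+ x :* con (+ 0) := (x :- z) :* con (+ 0) :+ (a :+ z :* con (+ 0))) refl a x z
  eval-quotient z (a ∷ b ∷ p) x = begin
    a + x * eval (b ∷ p) x
      ≈⟨ +-congˡ (*-congˡ (eval-quotient z (b ∷ p) x)) ⟩
    a + x * ((x - z) * Q + R)
      ≈⟨ solve 5 (λ a x z Q R → a :+ x :* ((x :- z) :* Q :+ R) := (x :- z) :* (R :+ x :* Q) :+ (a :+ z :* R)) refl a x z Q R ⟩
    (x - z) * (R + x * Q) + (a + z * R)  ∎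
    where
    Q = eval (quotient z (b ∷ p)) x
    R = eval (b ∷ p) z

  length-quotient : ∀ z p → length (quotient z p) ≡ length p ∸ 1
  length-quotient z []          = ≡.refl
  length-quotient z (a ∷ [])    = ≡.refl
  length-quotient z (a ∷ b ∷ p) = ≡.cong suc (length-quotient z (b ∷ p))

  quotient-coeff≈0 : ∀ z p → (∀ j → coeff (quotient z p) j ≈ 0#) → eval p z ≈ 0# → ∀ j → coeff p j ≈ 0#
  quotient-coeff≈0 z []          q≈0 pz≈0 j       = refl
  quotient-coeff≈0 z (a ∷ [])    q≈0 pz≈0 zero    = trans (sym (trans (+-congˡ (zeroʳ z)) (+-identityʳ a))) pz≈0
  quotient-coeff≈0 z (a ∷ [])    q≈0 pz≈0 (suc j) = refl
  quotient-coeff≈0 z (a ∷ b ∷ p) q≈0 pz≈0 zero    = begin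
    a                           ≈⟨ +-identityʳ a ⟨
    a + 0#                      ≈⟨ +-congˡ (trans (*-congˡ (q≈0 0)) (zeroʳ z)) ⟨
    a + z * eval (b ∷ p) z      ≈⟨ pz≈0 ⟩
    0#                          ∎
  quotient-coeff≈0 z (a ∷ b ∷ p) q≈0 pz≈0 (suc j) = quotient-coeff≈0 z (b ∷ p) (q≈0 ∘ suc) (q≈0 0) j


module PolynomialRing {c ℓ} (K : CommutativeRing c ℓ) (isField : IsField K) (infinite : IsInfinite K) where
  open CommutativeRing K
  open import Algebra.Properties.Ring ring using (x∙y⁻¹≈ε⇒x≈y; x≈y⇒x∙y⁻¹≈ε; +-cancelʳ)
  open ℤ-RingSolver K using (solve; _:+_; _:*_; _:=_; con)
  open Polynomial K public

  module K-Reasoning = Relation.Binary.Reasoning.Setoid setoid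

  x≉0⇒x*y≈0⇒y≈0 : ∀ {x y} → ¬ (x ≈ 0#) → x * y ≈ 0# → y ≈ 0#
  x≉0⇒x*y≈0⇒y≈0 {x} {y} x≉0 xy≈0 with proj₂ isField x x≉0
  ... | x⁻¹ , xx⁻¹≈1 = begin
    y                ≈⟨ *-identityˡ y ⟨
    1# * y           ≈⟨ *-congʳ xx⁻¹≈1 ⟨
    (x * x⁻¹) * y    ≈⟨ solve 3 (λ x x⁻¹ y → (x :* x⁻¹) :* y := x⁻¹ :* (x :* y)) refl x x⁻¹ y ⟩
    x⁻¹ * (x * y)    ≈⟨ *-congˡ xy≈0 ⟩
    x⁻¹ * 0#         ≈⟨ zeroʳ x⁻¹ ⟩
    0#               ∎
    where open K-Reasoning

  distinct-roots⇒coeff≈0 : ∀ n p (u : ℕ → Carrier) → length p ≤ n →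
    (∀ {i j} → i < n → j < n → u i ≈ u j → i ≡ j) →
    (∀ {i} → i < n → eval p (u i) ≈ 0#) →
    ∀ j → coeff p j ≈ 0#
  distinct-roots⇒coeff≈0 zero    []      u _   _        _     j = refl
  distinct-roots⇒coeff≈0 (suc n) p       u len distinct roots =
    quotient-coeff≈0 z p (distinct-roots⇒coeff≈0 n q (u ∘ suc) len-q distinct′ roots′) (roots (s≤s z≤n))
    where
    z = u 0
    q = quotient z p
    len-q : length q ≤ n
    len-q = ≡.subst (_≤ n) (≡.sym (length-quotient z p)) (ℕ.∸-monoˡ-≤ 1 len)
    distinct′ : ∀ {i j} → i < n → j < n → u (suc i) ≈ u (suc j) → i ≡ j
    distinct′ i<n j<n e = ℕ.suc-injective (distinct (s≤s i<n) (s≤s j<n) e)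
    roots′ : ∀ {i} → i < n → eval q (u (suc i)) ≈ 0#
    roots′ {i} i<n = x≉0⇒x*y≈0⇒y≈0 x-z≉0 (begin
      (x - z) * eval q x                ≈⟨ +-identityʳ _ ⟨
      (x - z) * eval q x + 0#           ≈⟨ +-congˡ (roots (s≤s z≤n)) ⟨
      (x - z) * eval q x + eval p z     ≈⟨ eval-quotient z p x ⟨
      eval p x                          ≈⟨ roots (s≤s i<n) ⟩
      0#                                ∎)
      where
      open K-Reasoning
      x = u (suc i)
      x-z≉0 : ¬ (x - z ≈ 0#)
      x-z≉0 e with distinct (s≤s i<n) (s≤s z≤n) (x∙y⁻¹≈ε⇒x≈y x z e)
      ... | ()

  private
    point : ℕ → Carrier
    point = proj₁ infinite

    point-injective : ∀ i j → point i ≈ point j → i ≡ j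
    point-injective = proj₂ infinite

  eval≈0⇒coeff≈0 : ∀ p → (∀ x → eval p x ≈ 0#) → ∀ j → coeff p j ≈ 0#
  eval≈0⇒coeff≈0 p p≈0 =
    distinct-roots⇒coeff≈0 (length p) p point ℕ.≤-refl (λ _ _ → point-injective _ _) (λ _ → p≈0 _)

  -- The points f i - f n (i < n) are distinct and nonzero, where f enumerates K injectively.
  eval≈0-off-0⇒coeff≈0 : ∀ p → (∀ x → ¬ (x ≈ 0#) → eval p x ≈ 0#) → ∀ j → coeff p j ≈ 0#
  eval≈0-off-0⇒coeff≈0 p p≈0 =
    distinct-roots⇒coeff≈0 n p u ℕ.≤-refl distinct (λ i<n → p≈0 _ (u≉0 i<n))
    where
    n = length p
    u : ℕ → Carrier
    u i = point i - point n
    distinct : ∀ {i j} → i < n → j < n → u i ≈ u j → i ≡ j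
    distinct _ _ e = point-injective _ _ (+-cancelʳ (- point n) _ _ e)
    u≉0 : ∀ {i} → i < n → ¬ (u i ≈ 0#)
    u≉0 i<n e = ℕ.<-irrefl (point-injective _ _ (x∙y⁻¹≈ε⇒x≈y _ _ e)) i<n

  coeff-difference : ∀ p q j → coeff (p +ᴾ -ᴾ q) j ≈ coeff p j - coeff q j
  coeff-difference p q j = trans (coeff-+ᴾ p (-ᴾ q) j) (+-congˡ (coeff--ᴾ q j))

  eval-difference : ∀ p q x → eval (p +ᴾ -ᴾ q) x ≈ eval p x - eval q x
  eval-difference p q x = trans (eval-+ᴾ p (-ᴾ q) x) (+-congˡ (eval--ᴾ q x))

  eval-injective : ∀ {p q} → (∀ x → eval p x ≈ eval q x) → p ≈ᴾ q
  eval-injective {p} {q} p≈q = mk≈ᴾ λ j → x∙y⁻¹≈ε⇒x≈y _ _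
    (trans (sym (coeff-difference p q j))
      (eval≈0⇒coeff≈0 (p +ᴾ -ᴾ q) (λ x → trans (eval-difference p q x) (x≈y⇒x∙y⁻¹≈ε (p≈q x))) j))

  eval-injective-off-0 : ∀ {p q} → (∀ x → ¬ (x ≈ 0#) → eval p x ≈ eval q x) → p ≈ᴾ q
  eval-injective-off-0 {p} {q} p≈q = mk≈ᴾ λ j → x∙y⁻¹≈ε⇒x≈y _ _
    (trans (sym (coeff-difference p q j))
      (eval≈0-off-0⇒coeff≈0 (p +ᴾ -ᴾ q) (λ x x≉0 → trans (eval-difference p q x) (x≈y⇒x∙y⁻¹≈ε (p≈q x x≉0))) j))

  -- The ring laws for polynomials are transported along evaluation, which is injective because K is infinite.
  evaluation-isRingMonomorphism :
    IsRingMonomorphism (record { _≈_ = _≈ᴾ_ ; _+_ = _+ᴾ_ ; _*_ = _*ᴾ_ ; -_ = -ᴾ_ ; 0# = [] ; 1# = 1ᴾ })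
                       (CommutativeRing.rawRing (Pointwise.commutativeRing Carrier K)) eval
  evaluation-isRingMonomorphism = record
    { isRingHomomorphism = record
      { isSemiringHomomorphism = record
        { isNearSemiringHomomorphism = record
          { +-isMonoidHomomorphism = record
            { isMagmaHomomorphism = record
              { isRelHomomorphism = record { cong = eval-cong }
              ; homo = eval-+ᴾ }
            ; ε-homo = λ _ → refl }
          ; *-homo = eval-*ᴾ }
        ; 1#-homo = λ x → trans (+-congˡ (zeroʳ x)) (+-identityʳ 1#) }
      ; -‿homo = eval--ᴾ }
    ; injective = eval-injective }

  ℙ : CommutativeRing c ℓ
  ℙ = record { isCommutativeRing = RingMonomorphism.isCommutativeRing evaluation-isRingMonomorphism
                                     (CommutativeRing.isCommutativeRing (Pointwise.commutativeRing Carrier K)) }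

  module ℙ = CommutativeRing ℙ
  module ℙ-Reasoning = Relation.Binary.Reasoning.Setoid ℙ.setoid

  open ℤ-RingSolver ℙ public using ()
    renaming (solve to solveᴾ; _:+_ to _:+ᴾ_; _:*_ to _:*ᴾ_; _:-_ to _:-ᴾ_; :-_ to :-ᴾ_; _:=_ to _:=ᴾ_; con to conᴾ)

  const : Carrier → Poly
  const a = a ∷ []

  X : Poly
  X = 0# ∷ 1# ∷ []

  X^ : ℕ → Poly
  X^ zero    = 1ᴾ
  X^ (suc n) = 0# ∷ X^ n

  ∷-cong : ∀ {a b p q} → a ≈ b → p ≈ᴾ q → a ∷ p ≈ᴾ b ∷ q
  ∷-cong a≈b p≈q = mk≈ᴾ λ { zero → a≈b ; (suc j) → coeff-≈ p≈q j }

  ∷≈const+X* : ∀ a p → a ∷ p ≈ᴾ const a +ᴾ X *ᴾ p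
  ∷≈const+X* a p = eval-injective λ x → begin
    a + x * eval p x
      ≈⟨ solve 3 (λ a x u → a :+ x :* u
                          := (a :+ x :* con (+ 0)) :+ (con (+ 0) :+ x :* (con (+ 1) :+ x :* con (+ 0))) :* u)
                 refl a x (eval p x) ⟩
    (a + x * 0#) + (0# + x * (1# + x * 0#)) * eval p x
      ≈⟨ +-congˡ (eval-*ᴾ X p x) ⟨
    (a + x * 0#) + eval (X *ᴾ p) x
      ≈⟨ eval-+ᴾ (const a) (X *ᴾ p) x ⟨
    eval (const a +ᴾ X *ᴾ p) x  ∎
    where open K-Reasoning

  0∷≈X* : ∀ p → 0# ∷ p ≈ᴾ X *ᴾ p
  0∷≈X* p = ℙ.trans (∷≈const+X* 0# p) (ℙ.trans (ℙ.+-congʳ const-0) (ℙ.+-identityˡ (X *ᴾ p)))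
    where
    const-0 : const 0# ≈ᴾ []
    const-0 = mk≈ᴾ λ { zero → refl ; (suc j) → refl }

  scale≈const* : ∀ a p → scale a p ≈ᴾ const a *ᴾ p
  scale≈const* a p = eval-injective λ x → begin
    eval (scale a p) x          ≈⟨ eval-scale a p x ⟩
    a * eval p x                ≈⟨ *-congʳ (+-identityʳ a) ⟨
    (a + 0#) * eval p x         ≈⟨ *-congʳ (+-congˡ (zeroʳ x)) ⟨
    (a + x * 0#) * eval p x     ≈⟨ eval-*ᴾ (const a) p x ⟨
    eval (const a *ᴾ p) x       ∎
    where open K-Reasoning

  coeff-X*-suc : ∀ p j → coeff (X *ᴾ p) (suc j) ≈ coeff p j
  coeff-X*-suc p j = sym (coeff-≈ (0∷≈X* p) (suc j))

  coeff-X*-zero : ∀ p → coeff (X *ᴾ p) 0 ≈ 0#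
  coeff-X*-zero p = sym (coeff-≈ (0∷≈X* p) 0)

  coeff-*ᴾ-zero : ∀ p q → coeff (p *ᴾ q) 0 ≈ coeff p 0 * coeff q 0
  coeff-*ᴾ-zero []      q = sym (zeroˡ _)
  coeff-*ᴾ-zero (a ∷ p) q = trans (coeff-+ᴾ (scale a q) (0# ∷ p *ᴾ q) 0) (trans (+-identityʳ _) (coeff-scale a q 0))

  coeff-∷*ᴾ-suc : ∀ a p q j → coeff ((a ∷ p) *ᴾ q) (suc j) ≈ a * coeff q (suc j) + coeff (p *ᴾ q) j
  coeff-∷*ᴾ-suc a p q j = trans (coeff-+ᴾ (scale a q) (0# ∷ p *ᴾ q) (suc j)) (+-congʳ (coeff-scale a q (suc j)))


module Truncation {c ℓ} (K : CommutativeRing c ℓ) (isField : IsField K) (infinite : IsInfinite K) where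
  open CommutativeRing K
  open import Algebra.Properties.Ring ring using (x∙y⁻¹≈ε⇒x≈y; x≈y⇒x∙y⁻¹≈ε)
  open PolynomialRing K isField infinite public

  infix 4 _≈ᴾ_mod-X^_
  record _≈ᴾ_mod-X^_ (p q : Poly) (n : ℕ) : Set ℓ where
    constructor mk≈mod
    field low-coeff-≈ : ∀ {j} → j < n → coeff p j ≈ coeff q j
  open _≈ᴾ_mod-X^_ public

  ≈mod-isEquivalence : ∀ n → IsEquivalence (λ p q → p ≈ᴾ q mod-X^ n)
  ≈mod-isEquivalence n = record
    { refl  = mk≈mod λ _ → refl
    ; sym   = λ p≈q → mk≈mod λ j<n → sym (low-coeff-≈ p≈q j<n)
    ; trans = λ p≈q q≈r → mk≈mod λ j<n → trans (low-coeff-≈ p≈q j<n) (low-coeff-≈ q≈r j<n) }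

  mod-X^-setoid : ℕ → Setoid c ℓ
  mod-X^-setoid n = record { isEquivalence = ≈mod-isEquivalence n }

  module ≈mod {n} = IsEquivalence (≈mod-isEquivalence n)
  module mod-Reasoning n = Relation.Binary.Reasoning.Setoid (mod-X^-setoid n)

  ≈ᴾ⇒≈mod : ∀ {p q n} → p ≈ᴾ q → p ≈ᴾ q mod-X^ n
  ≈ᴾ⇒≈mod p≈q = mk≈mod λ {j} _ → coeff-≈ p≈q j

  ≈mod-weaken : ∀ {p q m n} → m ≤ n → p ≈ᴾ q mod-X^ n → p ≈ᴾ q mod-X^ m
  ≈mod-weaken m≤n p≈q = mk≈mod λ j<m → low-coeff-≈ p≈q (ℕ.<-≤-trans j<m m≤n)

  +ᴾ-cong-mod : ∀ {p p′ q q′ n} → p ≈ᴾ p′ mod-X^ n → q ≈ᴾ q′ mod-X^ n → p +ᴾ q ≈ᴾ p′ +ᴾ q′ mod-X^ n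
  +ᴾ-cong-mod {p} {p′} {q} {q′} p≈p′ q≈q′ = mk≈mod λ {j} j<n →
    trans (coeff-+ᴾ p q j) (trans (+-cong (low-coeff-≈ p≈p′ j<n) (low-coeff-≈ q≈q′ j<n)) (sym (coeff-+ᴾ p′ q′ j)))

  -ᴾ-cong-mod : ∀ {p p′ n} → p ≈ᴾ p′ mod-X^ n → -ᴾ p ≈ᴾ -ᴾ p′ mod-X^ n
  -ᴾ-cong-mod {p} {p′} p≈p′ = mk≈mod λ {j} j<n →
    trans (coeff--ᴾ p j) (trans (-‿cong (low-coeff-≈ p≈p′ j<n)) (sym (coeff--ᴾ p′ j)))

  +ᴾ-≈0-mod : ∀ {p q n} → q ≈ᴾ [] mod-X^ n → p +ᴾ q ≈ᴾ p mod-X^ n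
  +ᴾ-≈0-mod {p} {q} q≈0 = mk≈mod λ {j} j<n →
    trans (coeff-+ᴾ p q j) (trans (+-congˡ (low-coeff-≈ q≈0 j<n)) (+-identityʳ _))

  *ᴾ-≈0-mod : ∀ {u n} r → u ≈ᴾ [] mod-X^ n → u *ᴾ r ≈ᴾ [] mod-X^ n
  *ᴾ-≈0-mod {[]}              r _   = mk≈mod λ _ → refl
  *ᴾ-≈0-mod {a ∷ u} {zero}    r _   = mk≈mod λ ()
  *ᴾ-≈0-mod {a ∷ u} {suc n}   r u≈0 = mk≈mod λ
    { {zero}  _         → trans (coeff-*ᴾ-zero (a ∷ u) r) (a*≈0 _)
    ; {suc j} (s≤s j<n) → trans (coeff-∷*ᴾ-suc a u r j)
                            (trans (+-cong (a*≈0 _) (low-coeff-≈ (*ᴾ-≈0-mod {u} r tail≈0) j<n)) (+-identityˡ 0#)) }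
    where
    a*≈0 : ∀ x → a * x ≈ 0#
    a*≈0 x = trans (*-congʳ (low-coeff-≈ u≈0 (s≤s z≤n))) (zeroˡ x)
    tail≈0 : u ≈ᴾ [] mod-X^ n
    tail≈0 = mk≈mod λ j<n → low-coeff-≈ u≈0 (s≤s j<n)

  X*ᴾ-cong-mod : ∀ {p q n} → p ≈ᴾ q mod-X^ n → X *ᴾ p ≈ᴾ X *ᴾ q mod-X^ suc n
  X*ᴾ-cong-mod {p} {q} p≈q = mk≈mod λ
    { {zero}  _         → trans (coeff-X*-zero p) (sym (coeff-X*-zero q))
    ; {suc j} (s≤s j<n) → trans (coeff-X*-suc p j) (trans (low-coeff-≈ p≈q j<n) (sym (coeff-X*-suc q j))) }

  ≈mod⇒difference≈0 : ∀ {p q n} → p ≈ᴾ q mod-X^ n → p +ᴾ -ᴾ q ≈ᴾ [] mod-X^ n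
  ≈mod⇒difference≈0 {p} {q} p≈q = mk≈mod λ {j} j<n →
    trans (coeff-difference p q j) (x≈y⇒x∙y⁻¹≈ε (low-coeff-≈ p≈q j<n))

  difference≈0⇒≈mod : ∀ {p q n} → p +ᴾ -ᴾ q ≈ᴾ [] mod-X^ n → p ≈ᴾ q mod-X^ n
  difference≈0⇒≈mod {p} {q} p-q≈0 = mk≈mod λ {j} j<n →
    x∙y⁻¹≈ε⇒x≈y _ _ (trans (sym (coeff-difference p q j)) (low-coeff-≈ p-q≈0 j<n))

  *ᴾ-congʳ-mod : ∀ {p q n} r → p ≈ᴾ q mod-X^ n → p *ᴾ r ≈ᴾ q *ᴾ r mod-X^ n
  *ᴾ-congʳ-mod {p} {q} r p≈q = difference≈0⇒≈mod (begin
    p *ᴾ r +ᴾ -ᴾ (q *ᴾ r)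
      ≈⟨ ≈ᴾ⇒≈mod (solveᴾ 3 (λ p q r → p :*ᴾ r :-ᴾ q :*ᴾ r :=ᴾ (p :-ᴾ q) :*ᴾ r) ℙ.refl p q r) ⟩
    (p +ᴾ -ᴾ q) *ᴾ r
      ≈⟨ *ᴾ-≈0-mod {p +ᴾ -ᴾ q} r (≈mod⇒difference≈0 p≈q) ⟩
    []  ∎)
    where open mod-Reasoning _

  *ᴾ-congˡ-mod : ∀ {p q n} r → p ≈ᴾ q mod-X^ n → r *ᴾ p ≈ᴾ r *ᴾ q mod-X^ n
  *ᴾ-congˡ-mod {p} {q} r p≈q = begin
    r *ᴾ p    ≈⟨ ≈ᴾ⇒≈mod (ℙ.*-comm r p) ⟩
    p *ᴾ r    ≈⟨ *ᴾ-congʳ-mod r p≈q ⟩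
    q *ᴾ r    ≈⟨ ≈ᴾ⇒≈mod (ℙ.*-comm q r) ⟩
    r *ᴾ q    ∎
    where open mod-Reasoning _

  *ᴾ-unit-≈0-mod : ∀ {w} n u → coeff w 0 ≈ 1# → u *ᴾ w ≈ᴾ [] mod-X^ n → u ≈ᴾ [] mod-X^ n
  *ᴾ-unit-≈0-mod         n       []      w₀≈1 uw≈0 = mk≈mod λ _ → refl
  *ᴾ-unit-≈0-mod         zero    (a ∷ u) w₀≈1 uw≈0 = mk≈mod λ ()
  *ᴾ-unit-≈0-mod {w} (suc n) (a ∷ u) w₀≈1 uw≈0 = mk≈mod λ
    { {zero}  _         → a≈0
    ; {suc j} (s≤s j<n) → low-coeff-≈ (*ᴾ-unit-≈0-mod n u w₀≈1 uw≈0′) j<n }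
    where
    a≈0 : a ≈ 0#
    a≈0 = begin
      a                          ≈⟨ *-identityʳ a ⟨
      a * 1#                     ≈⟨ *-congˡ w₀≈1 ⟨
      a * coeff w 0              ≈⟨ coeff-*ᴾ-zero (a ∷ u) w ⟨
      coeff ((a ∷ u) *ᴾ w) 0     ≈⟨ low-coeff-≈ uw≈0 (s≤s z≤n) ⟩
      0#                         ∎
      where open K-Reasoning
    uw≈0′ : u *ᴾ w ≈ᴾ [] mod-X^ n
    uw≈0′ = mk≈mod λ {j} j<n → begin
      coeff (u *ᴾ w) j                          ≈⟨ +-identityˡ _ ⟨
      0# + coeff (u *ᴾ w) j                     ≈⟨ +-congʳ (trans (*-congʳ a≈0) (zeroˡ _)) ⟨
      a * coeff w (suc j) + coeff (u *ᴾ w) j    ≈⟨ coeff-∷*ᴾ-suc a u w j ⟨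
      coeff ((a ∷ u) *ᴾ w) (suc j)              ≈⟨ low-coeff-≈ uw≈0 (s≤s j<n) ⟩
      0#                                        ∎
      where open K-Reasoning

  *ᴾ-cancelˡ-mod : ∀ {p q n} w → coeff w 0 ≈ 1# → w *ᴾ p ≈ᴾ w *ᴾ q mod-X^ n → p ≈ᴾ q mod-X^ n
  *ᴾ-cancelˡ-mod {p} {q} {n} w w₀≈1 wp≈wq = difference≈0⇒≈mod (*ᴾ-unit-≈0-mod n (p +ᴾ -ᴾ q) w₀≈1 (begin
    (p +ᴾ -ᴾ q) *ᴾ w
      ≈⟨ ≈ᴾ⇒≈mod (solveᴾ 3 (λ p q w → (p :-ᴾ q) :*ᴾ w :=ᴾ w :*ᴾ p :-ᴾ w :*ᴾ q) ℙ.refl p q w) ⟩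
    w *ᴾ p +ᴾ -ᴾ (w *ᴾ q)
      ≈⟨ ≈mod⇒difference≈0 wp≈wq ⟩
    []  ∎))
    where open mod-Reasoning _

  coeff-X^-low : ∀ {n j} → j < n → coeff (X^ n) j ≈ 0#
  coeff-X^-low {suc n} {zero}  _         = refl
  coeff-X^-low {suc n} {suc j} (s≤s j<n) = coeff-X^-low j<n

  X^≈0-mod : ∀ n → X^ n ≈ᴾ [] mod-X^ n
  X^≈0-mod n = mk≈mod coeff-X^-low


module Degree {c ℓ} (K : CommutativeRing c ℓ) (isField : IsField K) (infinite : IsInfinite K) where
  open CommutativeRing K
  open import Algebra.Properties.Ring ring using (-0#≈0#)
  open Truncation K isField infinite public

  infix 4 deg_≤_
  deg_≤_ : Poly → ℕ → Set ℓ
  deg p ≤ d = ∀ j → d < j → coeff p j ≈ 0#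

  deg-mono : ∀ {p d e} → d ≤ e → deg p ≤ d → deg p ≤ e
  deg-mono d≤e p≤d j e<j = p≤d j (ℕ.≤-<-trans d≤e e<j)

  deg-+ᴾ : ∀ {p q d} → deg p ≤ d → deg q ≤ d → deg p +ᴾ q ≤ d
  deg-+ᴾ {p} {q} p≤d q≤d j d<j = trans (coeff-+ᴾ p q j) (trans (+-cong (p≤d j d<j) (q≤d j d<j)) (+-identityˡ 0#))

  deg--ᴾ : ∀ {p d} → deg p ≤ d → deg -ᴾ p ≤ d
  deg--ᴾ {p} p≤d j d<j = trans (coeff--ᴾ p j) (trans (-‿cong (p≤d j d<j)) -0#≈0#)

  deg-*ᴾ : ∀ {p q a b} → deg p ≤ a → deg q ≤ b → deg p *ᴾ q ≤ a ℕ.+ b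
  deg-*ᴾ {[]}    p≤a q≤b j       _   = refl
  deg-*ᴾ {x ∷ p} p≤a q≤b zero    ()
  deg-*ᴾ {x ∷ p} {q} {a} {b} p≤a q≤b (suc j) a+b<j = trans (coeff-∷*ᴾ-suc x p q j)
    (trans (+-cong (trans (*-congˡ (q≤b (suc j) (ℕ.≤-<-trans (ℕ.m≤n+m b a) a+b<j))) (zeroʳ x)) (tail-coeff a p≤a a+b<j))
           (+-identityˡ 0#))
    where
    tail-coeff : ∀ a → deg x ∷ p ≤ a → a ℕ.+ b < suc j → coeff (p *ᴾ q) j ≈ 0#
    tail-coeff zero    p≤0 _       = low-coeff-≈ (*ᴾ-≈0-mod {p} q (mk≈mod λ {i} _ → p≤0 (suc i) (s≤s z≤n))) ℕ.≤-refl
    tail-coeff (suc a) p≤a a+b<j = deg-*ᴾ {p} {q} {a} {b} (λ i a<i → p≤a (suc i) (s≤s a<i)) q≤b j (ℕ.≤-pred a+b<j)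

  deg-X^ : ∀ n → deg X^ n ≤ n
  deg-X^ zero    (suc zero)    _         = refl
  deg-X^ zero    (suc (suc j)) _         = refl
  deg-X^ (suc n) (suc j)       (s≤s n<j) = deg-X^ n j n<j

  deg-1ᴾ : deg 1ᴾ ≤ 0
  deg-1ᴾ = deg-X^ 0


module EulerOperator {c ℓ} (K : CommutativeRing c ℓ) (isField : IsField K) (infinite : IsInfinite K) where
  open CommutativeRing K
  open import Algebra.Properties.CommutativeSemigroup *-commutativeSemigroup using (x∙yz≈y∙xz)
  open import Algebra.Properties.Semiring.Mult semiring using () renaming (_×_ to _·_)
  open ℤ-RingSolver K using (solve; _:+_; _:*_; _:=_; con)
  open Degree K isField infinite public

  θ : Poly → Poly
  θ []      = []
  θ (a ∷ p) = 0# ∷ (p +ᴾ θ p)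

  coeff-θ : ∀ p j → coeff (θ p) j ≈ (j · 1#) * coeff p j
  coeff-θ []      j       = sym (zeroʳ _)
  coeff-θ (a ∷ p) zero    = sym (zeroˡ a)
  coeff-θ (a ∷ p) (suc j) = begin
    coeff (p +ᴾ θ p) j                       ≈⟨ coeff-+ᴾ p (θ p) j ⟩
    coeff p j + coeff (θ p) j                ≈⟨ +-congˡ (coeff-θ p j) ⟩
    coeff p j + (j · 1#) * coeff p j         ≈⟨ solve 2 (λ c n → c :+ n :* c := (con (+ 1) :+ n) :* c) refl (coeff p j) (j · 1#) ⟩
    (1# + j · 1#) * coeff p j                ∎
    where open K-Reasoning

  θ-cong-mod : ∀ {p q n} → p ≈ᴾ q mod-X^ n → θ p ≈ᴾ θ q mod-X^ n
  θ-cong-mod {p} {q} p≈q = mk≈mod λ {j} j<n → trans (coeff-θ p j) (trans (*-congˡ (low-coeff-≈ p≈q j<n)) (sym (coeff-θ q j)))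

  deg-θ : ∀ {p d} → deg p ≤ d → deg θ p ≤ d
  deg-θ {p} p≤d j d<j = trans (coeff-θ p j) (trans (*-congˡ (p≤d j d<j)) (zeroʳ _))

  θ-+ᴾ : ∀ p q → θ (p +ᴾ q) ≈ᴾ θ p +ᴾ θ q
  θ-+ᴾ p q = mk≈ᴾ λ j → begin
    coeff (θ (p +ᴾ q)) j                          ≈⟨ coeff-θ (p +ᴾ q) j ⟩
    (j · 1#) * coeff (p +ᴾ q) j                   ≈⟨ *-congˡ (coeff-+ᴾ p q j) ⟩
    (j · 1#) * (coeff p j + coeff q j)            ≈⟨ distribˡ _ _ _ ⟩
    (j · 1#) * coeff p j + (j · 1#) * coeff q j   ≈⟨ +-cong (coeff-θ p j) (coeff-θ q j) ⟨
    coeff (θ p) j + coeff (θ q) j                 ≈⟨ coeff-+ᴾ (θ p) (θ q) j ⟨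
    coeff (θ p +ᴾ θ q) j                          ∎
    where open K-Reasoning

  θ-scale : ∀ a p → θ (scale a p) ≈ᴾ scale a (θ p)
  θ-scale a p = mk≈ᴾ λ j → begin
    coeff (θ (scale a p)) j             ≈⟨ coeff-θ (scale a p) j ⟩
    (j · 1#) * coeff (scale a p) j      ≈⟨ *-congˡ (coeff-scale a p j) ⟩
    (j · 1#) * (a * coeff p j)          ≈⟨ x∙yz≈y∙xz _ a _ ⟩
    a * ((j · 1#) * coeff p j)          ≈⟨ *-congˡ (coeff-θ p j) ⟨
    a * coeff (θ p) j                   ≈⟨ coeff-scale a (θ p) j ⟨
    coeff (scale a (θ p)) j             ∎
    where open K-Reasoning

  θ-*ᴾ : ∀ p q → θ (p *ᴾ q) ≈ᴾ θ p *ᴾ q +ᴾ p *ᴾ θ q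
  θ-*ᴾ []      q = ℙ.refl
  θ-*ᴾ (a ∷ p) q = begin
    θ (scale a q +ᴾ (0# ∷ p *ᴾ q))
      ≈⟨ θ-+ᴾ (scale a q) (0# ∷ p *ᴾ q) ⟩
    θ (scale a q) +ᴾ (0# ∷ (p *ᴾ q +ᴾ θ (p *ᴾ q)))
      ≈⟨ ℙ.+-cong (ℙ.trans (θ-scale a q) (scale≈const* a (θ q))) (0∷≈X* (p *ᴾ q +ᴾ θ (p *ᴾ q))) ⟩
    const a *ᴾ θ q +ᴾ X *ᴾ (p *ᴾ q +ᴾ θ (p *ᴾ q))
      ≈⟨ ℙ.+-congˡ {const a *ᴾ θ q} (ℙ.*-congˡ {X} (ℙ.+-congˡ {p *ᴾ q} (θ-*ᴾ p q))) ⟩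
    const a *ᴾ θ q +ᴾ X *ᴾ (p *ᴾ q +ᴾ (θ p *ᴾ q +ᴾ p *ᴾ θ q))
      ≈⟨ solveᴾ 6 (λ A x p q θp θq → A :*ᴾ θq :+ᴾ x :*ᴾ (p :*ᴾ q :+ᴾ (θp :*ᴾ q :+ᴾ p :*ᴾ θq))
                                       :=ᴾ (x :*ᴾ (p :+ᴾ θp)) :*ᴾ q :+ᴾ (A :+ᴾ x :*ᴾ p) :*ᴾ θq)
                 ℙ.refl (const a) X p q (θ p) (θ q) ⟩
    (X *ᴾ (p +ᴾ θ p)) *ᴾ q +ᴾ (const a +ᴾ X *ᴾ p) *ᴾ θ q
      ≈⟨ ℙ.+-cong (ℙ.*-congʳ (0∷≈X* (p +ᴾ θ p))) (ℙ.*-congʳ (∷≈const+X* a p)) ⟨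
    θ (a ∷ p) *ᴾ q +ᴾ (a ∷ p) *ᴾ θ q  ∎
    where open ℙ-Reasoning


module Reversal {c ℓ} (K : CommutativeRing c ℓ) (isField : IsField K) (infinite : IsInfinite K) where
  open CommutativeRing K
  open ℤ-RingSolver K using (solve; _:+_; _:*_; _:=_; con)
  open EulerOperator K isField infinite public

  reverse : ℕ → Poly → Poly
  reverse zero    ρ = coeff ρ 0 ∷ []
  reverse (suc d) ρ = coeff ρ (suc d) ∷ reverse d ρ

  -- For deg ρ ≤ d this is x ^ d * ρ (1 / x), the polynomial of which ρ is the reversal.
  evalRev : ℕ → Poly → Carrier → Carrier
  evalRev d ρ = eval (reverse d ρ)

  coeff-reverse : ∀ ρ {d j} → j ≤ d → coeff (reverse d ρ) j ≡ coeff ρ (d ∸ j)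
  coeff-reverse ρ {zero}  {zero}  _         = ≡.refl
  coeff-reverse ρ {suc d} {zero}  _         = ≡.refl
  coeff-reverse ρ {suc d} {suc j} (s≤s j≤d) = coeff-reverse ρ j≤d

  coeff-reverse-high : ∀ ρ {d j} → d < j → coeff (reverse d ρ) j ≡ 0#
  coeff-reverse-high ρ {zero}  {suc zero}    _         = ≡.refl
  coeff-reverse-high ρ {zero}  {suc (suc j)} _         = ≡.refl
  coeff-reverse-high ρ {suc d} {suc j}       (s≤s d<j) = coeff-reverse-high ρ d<j

  reverse-+ᴾ : ∀ p q d → reverse d (p +ᴾ q) ≈ᴾ reverse d p +ᴾ reverse d q
  reverse-+ᴾ p q zero    = ∷-cong (coeff-+ᴾ p q 0) ℙ.refl
  reverse-+ᴾ p q (suc d) = ∷-cong (coeff-+ᴾ p q (suc d)) (reverse-+ᴾ p q d)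

  evalRev-+ᴾ : ∀ p q d x → evalRev d (p +ᴾ q) x ≈ evalRev d p x + evalRev d q x
  evalRev-+ᴾ p q d x = trans (eval-cong (reverse-+ᴾ p q d) x) (eval-+ᴾ (reverse d p) (reverse d q) x)

  pow-+ : ∀ x m n → pow K x (m ℕ.+ n) ≈ pow K x m * pow K x n
  pow-+ x zero    n = sym (*-identityˡ _)
  pow-+ x (suc m) n = trans (*-congˡ (pow-+ x m n)) (sym (*-assoc _ _ _))

  pow-inverse : ∀ {x y} n → x * y ≈ 1# → pow K x n * pow K y n ≈ 1#
  pow-inverse zero    xy≈1 = *-identityˡ 1#
  pow-inverse {x} {y} (suc n) xy≈1 = begin
    (x * pow K x n) * (y * pow K y n)
      ≈⟨ solve 4 (λ x xⁿ y yⁿ → (x :* xⁿ) :* (y :* yⁿ) := (x :* y) :* (xⁿ :* yⁿ)) refl x (pow K x n) y (pow K y n) ⟩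
    (x * y) * (pow K x n * pow K y n)
      ≈⟨ *-cong xy≈1 (pow-inverse n xy≈1) ⟩
    1# * 1#
      ≈⟨ *-identityˡ 1# ⟩
    1#  ∎
    where open K-Reasoning

  evalUpTo : ℕ → Poly → Carrier → Carrier
  evalUpTo zero    ρ y = coeff ρ 0
  evalUpTo (suc d) ρ y = evalUpTo d ρ y + coeff ρ (suc d) * pow K y (suc d)

  evalUpTo-∷ : ∀ a ρ d y → evalUpTo (suc d) (a ∷ ρ) y ≈ a + y * evalUpTo d ρ y
  evalUpTo-∷ a ρ zero    y = solve 3 (λ a r y → a :+ r :* (y :* con (+ 1)) := a :+ y :* r) refl a (coeff ρ 0) y
  evalUpTo-∷ a ρ (suc d) y = begin
    evalUpTo (suc d) (a ∷ ρ) y + r * (y * yᵈ)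
      ≈⟨ +-congʳ (evalUpTo-∷ a ρ d y) ⟩
    (a + y * E) + r * (y * yᵈ)
      ≈⟨ solve 5 (λ a y E r yᵈ → (a :+ y :* E) :+ r :* (y :* yᵈ) := a :+ y :* (E :+ r :* yᵈ)) refl a y E r yᵈ ⟩
    a + y * (E + r * yᵈ)  ∎
    where
    open K-Reasoning
    E  = evalUpTo d ρ y
    r  = coeff ρ (suc d)
    yᵈ = pow K y (suc d)

  eval≈evalUpTo : ∀ {ρ d} y → deg ρ ≤ d → eval ρ y ≈ evalUpTo d ρ y
  eval≈evalUpTo {[]}    {zero}  y _   = refl
  eval≈evalUpTo {[]}    {suc d} y _   = begin
    0#                               ≈⟨ solve 1 (λ yᵈ → con (+ 0) := con (+ 0) :+ con (+ 0) :* yᵈ) refl (pow K y (suc d)) ⟩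
    0# + 0# * pow K y (suc d)        ≈⟨ +-congʳ (eval≈evalUpTo {[]} {d} y (λ _ _ → refl)) ⟩
    evalUpTo d [] y + 0# * pow K y (suc d) ∎
    where open K-Reasoning
  eval≈evalUpTo {a ∷ ρ} {zero}  y ρ≤0 =
    trans (+-congˡ (trans (*-congˡ (coeff≈0⇒eval≈0 ρ (λ j → ρ≤0 (suc j) (s≤s z≤n)) y)) (zeroʳ y))) (+-identityʳ a)
  eval≈evalUpTo {a ∷ ρ} {suc d} y ρ≤d =
    trans (+-congˡ (*-congˡ (eval≈evalUpTo y (λ j d<j → ρ≤d (suc j) (s≤s d<j))))) (sym (evalUpTo-∷ a ρ d y))

  evalRev≈pow*evalUpTo : ∀ {x y} ρ d → x * y ≈ 1# → evalRev d ρ x ≈ pow K x d * evalUpTo d ρ y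
  evalRev≈pow*evalUpTo ρ zero    xy≈1 = trans (+-congˡ (zeroʳ _)) (trans (+-identityʳ _) (sym (*-identityˡ _)))
  evalRev≈pow*evalUpTo {x} {y} ρ (suc d) xy≈1 = begin
    r + x * evalRev d ρ x
      ≈⟨ +-congˡ (*-congˡ (evalRev≈pow*evalUpTo ρ d xy≈1)) ⟩
    r + x * (xᵈ * E)
      ≈⟨ +-congʳ (*-identityˡ r) ⟨
    1# * r + x * (xᵈ * E)
      ≈⟨ +-congʳ (*-congʳ (trans (*-cong xy≈1 (pow-inverse d xy≈1)) (*-identityˡ 1#))) ⟨
    ((x * y) * (xᵈ * yᵈ)) * r + x * (xᵈ * E)
      ≈⟨ solve 6 (λ x y xᵈ yᵈ r E → ((x :* y) :* (xᵈ :* yᵈ)) :* r :+ x :* (xᵈ :* E)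
                                 := (x :* xᵈ) :* (E :+ r :* (y :* yᵈ)))
                 refl x y xᵈ yᵈ r E ⟩
    (x * xᵈ) * (E + r * (y * yᵈ))  ∎
    where
    open K-Reasoning
    r  = coeff ρ (suc d)
    xᵈ = pow K x d
    yᵈ = pow K y d
    E  = evalUpTo d ρ y

  evalRev-inverse : ∀ {ρ d x y} → x * y ≈ 1# → deg ρ ≤ d → evalRev d ρ x ≈ pow K x d * eval ρ y
  evalRev-inverse {ρ} {d} {y = y} xy≈1 ρ≤d = trans (evalRev≈pow*evalUpTo ρ d xy≈1) (*-congˡ (sym (eval≈evalUpTo y ρ≤d)))

  -- Compare both sides at invertible x, where evalRev d ρ x = x ^ d * ρ (x⁻¹).
  reverse-*ᴾ : ∀ {p q a b} → deg p ≤ a → deg q ≤ b → reverse (a ℕ.+ b) (p *ᴾ q) ≈ᴾ reverse a p *ᴾ reverse b q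
  reverse-*ᴾ {p} {q} {a} {b} p≤a q≤b = eval-injective-off-0 λ x x≉0 → agree x (proj₂ isField x x≉0)
    where
    open K-Reasoning
    agree : ∀ x → ∃ (λ y → x * y ≈ 1#) → evalRev (a ℕ.+ b) (p *ᴾ q) x ≈ eval (reverse a p *ᴾ reverse b q) x
    agree x (y , xy≈1) = begin
      evalRev (a ℕ.+ b) (p *ᴾ q) x
        ≈⟨ evalRev-inverse xy≈1 (deg-*ᴾ {p} {q} p≤a q≤b) ⟩
      pow K x (a ℕ.+ b) * eval (p *ᴾ q) y
        ≈⟨ *-cong (pow-+ x a b) (eval-*ᴾ p q y) ⟩
      (pow K x a * pow K x b) * (eval p y * eval q y)
        ≈⟨ solve 4 (λ A B P Q → (A :* B) :* (P :* Q) := (A :* P) :* (B :* Q)) refl (pow K x a) (pow K x b) (eval p y) (eval q y) ⟩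
      (pow K x a * eval p y) * (pow K x b * eval q y)
        ≈⟨ *-cong (evalRev-inverse xy≈1 p≤a) (evalRev-inverse xy≈1 q≤b) ⟨
      evalRev a p x * evalRev b q x
        ≈⟨ eval-*ᴾ (reverse a p) (reverse b q) x ⟨
      eval (reverse a p *ᴾ reverse b q) x  ∎

  evalRev-*ᴾ : ∀ {p q a b} x → deg p ≤ a → deg q ≤ b → evalRev (a ℕ.+ b) (p *ᴾ q) x ≈ evalRev a p x * evalRev b q x
  evalRev-*ᴾ {p} {q} {a} {b} x p≤a q≤b = trans (eval-cong (reverse-*ᴾ {p} {q} p≤a q≤b) x) (eval-*ᴾ (reverse a p) (reverse b q) x)

  evalRev-1ᴾ : ∀ k x → evalRev k 1ᴾ x ≈ pow K x k
  evalRev-1ᴾ zero    x = trans (+-congˡ (zeroʳ x)) (+-identityʳ 1#)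
  evalRev-1ᴾ (suc k) x = trans (+-identityˡ _) (*-congˡ (evalRev-1ᴾ k x))

  evalRev-low : ∀ {ρ} d x → (∀ {j} → j ≤ d → coeff ρ j ≈ 0#) → evalRev d ρ x ≈ 0#
  evalRev-low zero    x ρ≈0 = trans (+-cong (ρ≈0 z≤n) (zeroʳ x)) (+-identityʳ 0#)
  evalRev-low (suc d) x ρ≈0 =
    trans (+-cong (ρ≈0 ℕ.≤-refl) (trans (*-congˡ (evalRev-low d x (ρ≈0 ∘ ℕ.m≤n⇒m≤1+n))) (zeroʳ x))) (+-identityʳ 0#)

  coeff-X^-top : ∀ n → coeff (X^ n) n ≈ 1#
  coeff-X^-top zero    = refl
  coeff-X^-top (suc n) = coeff-X^-top n

  evalRev-X^ : ∀ n x → evalRev n (X^ n) x ≈ 1#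
  evalRev-X^ zero    x = trans (+-congˡ (zeroʳ x)) (+-identityʳ 1#)
  evalRev-X^ (suc n) x = trans (+-cong (coeff-X^-top n) (trans (*-congˡ (evalRev-low n x (coeff-X^-low ∘ s≤s))) (zeroʳ x))) (+-identityʳ 1#)

  evalRev-X^-suc : ∀ n x → evalRev (suc n) (X^ n) x ≈ x
  evalRev-X^-suc n x = trans (+-cong (deg-X^ n (suc n) ℕ.≤-refl) (*-congˡ (evalRev-X^ n x))) (trans (+-identityˡ _) (*-identityʳ x))

  coeff-reverse-top : ∀ ρ d → coeff (reverse d ρ) d ≈ coeff ρ 0
  coeff-reverse-top ρ d = reflexive (≡.trans (coeff-reverse ρ {d} ℕ.≤-refl) (≡.cong (coeff ρ) (ℕ.n∸n≡0 d)))

  -- Reversals with constant term 1 have exact degree, which pins down L = D.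
  evalRev-injective : ∀ {ρ σ L D} → coeff ρ 0 ≈ 1# → coeff σ 0 ≈ 1# →
    (∀ x → evalRev L ρ x ≈ evalRev D σ x) → ρ ≈ᴾ σ mod-X^ suc D
  evalRev-injective {ρ} {σ} {L} {D} ρ₀≈1 σ₀≈1 ρ≈σ = mk≈mod λ {j} j<1+D → begin
    coeff ρ j                        ≡⟨ ≡.cong (coeff ρ) (ℕ.m∸[m∸n]≡n (ℕ.≤-pred j<1+D)) ⟨
    coeff ρ (D ∸ (D ∸ j))            ≡⟨ coeff-reverse ρ (ℕ.m∸n≤m D j) ⟨
    coeff (reverse D ρ) (D ∸ j)      ≈⟨ coeff-≈ reverseD-≈ (D ∸ j) ⟩
    coeff (reverse D σ) (D ∸ j)      ≡⟨ coeff-reverse σ (ℕ.m∸n≤m D j) ⟩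
    coeff σ (D ∸ (D ∸ j))            ≡⟨ ≡.cong (coeff σ) (ℕ.m∸[m∸n]≡n (ℕ.≤-pred j<1+D)) ⟩
    coeff σ j                        ∎
    where
    open K-Reasoning
    reverse-≈ : reverse L ρ ≈ᴾ reverse D σ
    reverse-≈ = eval-injective ρ≈σ
    1≉0 : ¬ (1# ≈ 0#)
    1≉0 = proj₁ isField
    L≡D : L ≡ D
    L≡D with ℕ.<-cmp L D
    ... | tri≈ _ L≡D _ = L≡D
    ... | tri< L<D _ _ = ⊥-elim (1≉0 (begin
      1#                         ≈⟨ trans (coeff-reverse-top σ D) σ₀≈1 ⟨
      coeff (reverse D σ) D      ≈⟨ coeff-≈ reverse-≈ D ⟨
      coeff (reverse L ρ) D      ≡⟨ coeff-reverse-high ρ L<D ⟩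
      0#                         ∎))
    ... | tri> _ _ D<L = ⊥-elim (1≉0 (begin
      1#                         ≈⟨ trans (coeff-reverse-top ρ L) ρ₀≈1 ⟨
      coeff (reverse L ρ) L      ≈⟨ coeff-≈ reverse-≈ L ⟩
      coeff (reverse D σ) L      ≡⟨ coeff-reverse-high σ D<L ⟩
      0#                         ∎))
    reverseD-≈ : reverse D ρ ≈ᴾ reverse D σ
    reverseD-≈ = ≡.subst (λ L → reverse L ρ ≈ᴾ reverse D σ) L≡D reverse-≈


module PowerSums {c ℓ} (K : CommutativeRing c ℓ) (isField : IsField K) (infinite : IsInfinite K) where
  open CommutativeRing K
  open Reversal K isField infinite public
  open ℤ-RingSolver K using (solve; _:+_; _:*_; _:-_; :-_; _:=_; con)
  open import Algebra.Properties.Semiring.Mult ℙ.semiring public using () renaming (_×_ to _·ᴾ_)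

  geometric : Carrier → ℕ → Poly
  geometric γ zero    = 1ᴾ
  geometric γ (suc d) = 1# ∷ scale γ (geometric γ d)

  *ᴾ-geometric-suc : ∀ ρ γ d → ρ *ᴾ geometric γ (suc d) ≈ᴾ ρ +ᴾ X *ᴾ (const γ *ᴾ (ρ *ᴾ geometric γ d))
  *ᴾ-geometric-suc ρ γ d = begin
    ρ *ᴾ (1# ∷ scale γ g)                        ≈⟨ ℙ.*-congˡ {ρ} (∷≈const+X* 1# (scale γ g)) ⟩
    ρ *ᴾ (1ᴾ +ᴾ X *ᴾ scale γ g)                  ≈⟨ ℙ.*-congˡ {ρ} (ℙ.+-congˡ {1ᴾ} (ℙ.*-congˡ {X} (scale≈const* γ g))) ⟩
    ρ *ᴾ (1ᴾ +ᴾ X *ᴾ (const γ *ᴾ g))             ≈⟨ solveᴾ 4 (λ ρ x G g → ρ :*ᴾ (conᴾ (+ 1) :+ᴾ x :*ᴾ (G :*ᴾ g)) :=ᴾ ρ :+ᴾ x :*ᴾ (G :*ᴾ (ρ :*ᴾ g)))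
                                                              ℙ.refl ρ X (const γ) g ⟩
    ρ +ᴾ X *ᴾ (const γ *ᴾ (ρ *ᴾ g))              ∎
    where
    open ℙ-Reasoning
    g = geometric γ d

  coeff-*ᴾ-geometric : ∀ ρ γ d → coeff (ρ *ᴾ geometric γ d) d ≈ evalRev d ρ γ
  coeff-*ᴾ-geometric ρ γ zero    = trans (coeff-≈ (ℙ.*-identityʳ ρ) 0) (sym (trans (+-congˡ (zeroʳ γ)) (+-identityʳ _)))
  coeff-*ᴾ-geometric ρ γ (suc d) = begin
    coeff (ρ *ᴾ geometric γ (suc d)) (suc d)                      ≈⟨ coeff-≈ (*ᴾ-geometric-suc ρ γ d) (suc d) ⟩
    coeff (ρ +ᴾ X *ᴾ (const γ *ᴾ (ρ *ᴾ geometric γ d))) (suc d)   ≈⟨ coeff-+ᴾ ρ _ (suc d) ⟩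
    coeff ρ (suc d) + coeff (X *ᴾ (const γ *ᴾ ρG)) (suc d)        ≈⟨ +-congˡ (coeff-X*-suc (const γ *ᴾ ρG) d) ⟩
    coeff ρ (suc d) + coeff (const γ *ᴾ ρG) d                     ≈⟨ +-congˡ (coeff-≈ (scale≈const* γ ρG) d) ⟨
    coeff ρ (suc d) + coeff (scale γ ρG) d                        ≈⟨ +-congˡ (coeff-scale γ ρG d) ⟩
    coeff ρ (suc d) + γ * coeff ρG d                              ≈⟨ +-congˡ (*-congˡ (coeff-*ᴾ-geometric ρ γ d)) ⟩
    coeff ρ (suc d) + γ * evalRev d ρ γ                           ∎
    where
    open K-Reasoning
    ρG = ρ *ᴾ geometric γ d

  linear : Carrier → Poly
  linear γ = 1# ∷ - γ ∷ []

  linear≈1-X*const : ∀ γ → linear γ ≈ᴾ 1ᴾ +ᴾ X *ᴾ -ᴾ const γ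
  linear≈1-X*const γ = ∷≈const+X* 1# (- γ ∷ [])

  θ-linear : ∀ γ → θ (linear γ) ≈ᴾ linear γ +ᴾ -ᴾ 1ᴾ
  θ-linear γ = mk≈ᴾ λ { zero → sym (-‿inverseʳ 1#) ; (suc zero) → +-identityʳ (- γ) ; (suc (suc j)) → refl }

  linear*geometric : ∀ γ d → linear γ *ᴾ geometric γ d ≈ᴾ 1ᴾ mod-X^ suc d
  linear*geometric γ zero    = mk≈mod λ { {zero} _ → trans (coeff-*ᴾ-zero (linear γ) 1ᴾ) (*-identityˡ 1#) ; {suc j} (s≤s ()) }
  linear*geometric γ (suc d) = begin
    linear γ *ᴾ geometric γ (suc d)
      ≈⟨ ≈ᴾ⇒≈mod (*ᴾ-geometric-suc (linear γ) γ d) ⟩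
    linear γ +ᴾ X *ᴾ (const γ *ᴾ (linear γ *ᴾ geometric γ d))
      ≈⟨ +ᴾ-cong-mod {linear γ} ≈mod.refl (X*ᴾ-cong-mod (*ᴾ-congˡ-mod (const γ) (linear*geometric γ d))) ⟩
    linear γ +ᴾ X *ᴾ (const γ *ᴾ 1ᴾ)
      ≈⟨ ≈ᴾ⇒≈mod collapse ⟩
    1ᴾ  ∎
    where
    open mod-Reasoning (suc (suc d))
    collapse : linear γ +ᴾ X *ᴾ (const γ *ᴾ 1ᴾ) ≈ᴾ 1ᴾ
    collapse = ℙ.trans (ℙ.+-congʳ {X *ᴾ (const γ *ᴾ 1ᴾ)} (linear≈1-X*const γ))
      (solveᴾ 2 (λ x G → (conᴾ (+ 1) :+ᴾ x :*ᴾ (:-ᴾ G)) :+ᴾ x :*ᴾ (G :*ᴾ conᴾ (+ 1)) :=ᴾ conᴾ (+ 1)) ℙ.refl X (const γ))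

  ∏linear : List Carrier → Poly
  ∏linear []       = 1ᴾ
  ∏linear (γ ∷ γs) = linear γ *ᴾ ∏linear γs

  Σgeometric : List Carrier → ℕ → Poly
  Σgeometric []       d = []
  Σgeometric (γ ∷ γs) d = geometric γ d +ᴾ Σgeometric γs d

  sum≈coeff-*ᴾ-Σgeometric : ∀ {f ρ d} → (∀ γ → f γ ≈ evalRev d ρ γ) →
    ∀ γs → sumL K (mapL K f γs) ≈ coeff (ρ *ᴾ Σgeometric γs d) d
  sum≈coeff-*ᴾ-Σgeometric {f} {ρ} {d} f≈ []       = sym (coeff-≈ (ℙ.zeroʳ ρ) d)
  sum≈coeff-*ᴾ-Σgeometric {f} {ρ} {d} f≈ (γ ∷ γs) = begin
    f γ + sumL K (mapL K f γs)
      ≈⟨ +-cong (trans (f≈ γ) (sym (coeff-*ᴾ-geometric ρ γ d))) (sum≈coeff-*ᴾ-Σgeometric {f} {ρ} {d} f≈ γs) ⟩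
    coeff (ρ *ᴾ geometric γ d) d + coeff (ρ *ᴾ Σgeometric γs d) d
      ≈⟨ coeff-+ᴾ (ρ *ᴾ geometric γ d) _ d ⟨
    coeff (ρ *ᴾ geometric γ d +ᴾ ρ *ᴾ Σgeometric γs d) d
      ≈⟨ coeff-≈ (ℙ.distribˡ ρ (geometric γ d) (Σgeometric γs d)) d ⟨
    coeff (ρ *ᴾ Σgeometric (γ ∷ γs) d) d  ∎
    where open K-Reasoning

  newton-identity-step : ∀ γ P N →
    1ᴾ *ᴾ P +ᴾ linear γ *ᴾ (N *ᴾ P +ᴾ -ᴾ θ P) ≈ᴾ (1ᴾ +ᴾ N) *ᴾ (linear γ *ᴾ P) +ᴾ -ᴾ θ (linear γ *ᴾ P)
  newton-identity-step γ P N = begin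
    1ᴾ *ᴾ P +ᴾ l *ᴾ (N *ᴾ P +ᴾ -ᴾ θ P)
      ≈⟨ solveᴾ 4 (λ l P N θP → conᴾ (+ 1) :*ᴾ P :+ᴾ l :*ᴾ (N :*ᴾ P :-ᴾ θP)
                               :=ᴾ (conᴾ (+ 1) :+ᴾ N) :*ᴾ (l :*ᴾ P) :-ᴾ ((l :-ᴾ conᴾ (+ 1)) :*ᴾ P :+ᴾ l :*ᴾ θP))
                 ℙ.refl l P N (θ P) ⟩
    (1ᴾ +ᴾ N) *ᴾ (l *ᴾ P) +ᴾ -ᴾ ((l +ᴾ -ᴾ 1ᴾ) *ᴾ P +ᴾ l *ᴾ θ P)
      ≈⟨ ℙ.+-congˡ {(1ᴾ +ᴾ N) *ᴾ (l *ᴾ P)} (ℙ.-‿cong (ℙ.+-congʳ {l *ᴾ θ P} (ℙ.*-congʳ {P} (θ-linear γ)))) ⟨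
    (1ᴾ +ᴾ N) *ᴾ (l *ᴾ P) +ᴾ -ᴾ (θ l *ᴾ P +ᴾ l *ᴾ θ P)
      ≈⟨ ℙ.+-congˡ {(1ᴾ +ᴾ N) *ᴾ (l *ᴾ P)} (ℙ.-‿cong (θ-*ᴾ l P)) ⟨
    (1ᴾ +ᴾ N) *ᴾ (l *ᴾ P) +ᴾ -ᴾ θ (l *ᴾ P)  ∎
    where
    open ℙ-Reasoning
    l = linear γ

  newton-identity : ∀ γs d →
    ∏linear γs *ᴾ Σgeometric γs d ≈ᴾ length γs ·ᴾ 1ᴾ *ᴾ ∏linear γs +ᴾ -ᴾ θ (∏linear γs) mod-X^ suc d
  newton-identity []       d = ≈ᴾ⇒≈mod (mk≈ᴾ λ { zero → sym -0#≈0# ; (suc j) → refl })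
    where open import Algebra.Properties.Ring ring using (-0#≈0#)
  newton-identity (γ ∷ γs) d = begin
    (l *ᴾ P) *ᴾ (geometric γ d +ᴾ E)
      ≈⟨ ≈ᴾ⇒≈mod (solveᴾ 4 (λ l P g E → (l :*ᴾ P) :*ᴾ (g :+ᴾ E) :=ᴾ (l :*ᴾ g) :*ᴾ P :+ᴾ l :*ᴾ (P :*ᴾ E))
                            ℙ.refl l P (geometric γ d) E) ⟩
    (l *ᴾ geometric γ d) *ᴾ P +ᴾ l *ᴾ (P *ᴾ E)
      ≈⟨ +ᴾ-cong-mod (*ᴾ-congʳ-mod P (linear*geometric γ d)) (*ᴾ-congˡ-mod l (newton-identity γs d)) ⟩
    1ᴾ *ᴾ P +ᴾ l *ᴾ (N *ᴾ P +ᴾ -ᴾ θ P)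
      ≈⟨ ≈ᴾ⇒≈mod (newton-identity-step γ P N) ⟩
    (1ᴾ +ᴾ N) *ᴾ (l *ᴾ P) +ᴾ -ᴾ θ (l *ᴾ P)  ∎
    where
    open mod-Reasoning (suc d)
    l = linear γ
    P = ∏linear γs
    E = Σgeometric γs d
    N = length γs ·ᴾ 1ᴾ

  deg-linear : ∀ γ → deg linear γ ≤ 1
  deg-linear γ (suc zero)    (s≤s ())
  deg-linear γ (suc (suc j)) _        = refl

  deg-∏linear : ∀ γs → deg ∏linear γs ≤ length γs
  deg-∏linear []       = deg-1ᴾ
  deg-∏linear (γ ∷ γs) = deg-*ᴾ {linear γ} {∏linear γs} (deg-linear γ) (deg-∏linear γs)

  coeff₀-∏linear : ∀ γs → coeff (∏linear γs) 0 ≈ 1#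
  coeff₀-∏linear []       = refl
  coeff₀-∏linear (γ ∷ γs) = trans (coeff-*ᴾ-zero (linear γ) (∏linear γs)) (trans (*-identityˡ _) (coeff₀-∏linear γs))

  evalRev-∏linear : ∀ γs x → evalRev (length γs) (∏linear γs) x ≈ linProd K γs x
  evalRev-∏linear []       x = evalRev-1ᴾ 0 x
  evalRev-∏linear (γ ∷ γs) x =
    trans (evalRev-*ᴾ {linear γ} x (deg-linear γ) (deg-∏linear γs)) (*-cong evalRev-linear (evalRev-∏linear γs x))
    where
    evalRev-linear : evalRev 1 (linear γ) x ≈ x - γ
    evalRev-linear = solve 2 (λ γ x → :- γ :+ x :* (con (+ 1) :+ x :* con (+ 0)) := x :- γ) refl γ x

  deg-·ᴾ1ᴾ : ∀ n → deg n ·ᴾ 1ᴾ ≤ 0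
  deg-·ᴾ1ᴾ zero    j _ = refl
  deg-·ᴾ1ᴾ (suc n) = deg-+ᴾ {1ᴾ} {n ·ᴾ 1ᴾ} deg-1ᴾ (deg-·ᴾ1ᴾ n)


module DegreeSums where
  open import Data.List.Relation.Unary.All as All using (All; []; _∷_)
  open import Data.List.Relation.Unary.All.Properties using (∷ʳ⁻)
  open import Data.List.Relation.Unary.AllPairs using (AllPairs; []; _∷_)
  open import Data.List.Relation.Unary.Any using (here; there)
  open import Data.List.Membership.Propositional using (_∉_)
  open import Data.Nat using (_+_)
  open ℕ.≤-Reasoning

  2^-suc : ∀ j → 2 ^ suc j ≡ 2 ^ j + 2 ^ j
  2^-suc j = ≡.cong (λ x → 2 ^ j + x) (ℕ.+-identityʳ (2 ^ j))

  1≤2^ : ∀ j → 1 ≤ 2 ^ j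
  1≤2^ j = ℕ.m^n>0 2 j

  [2^j∸1]+[2^j∸1]≤2^[1+j]∸1 : ∀ j → (2 ^ j ∸ 1) + (2 ^ j ∸ 1) ≤ 2 ^ suc j ∸ 1
  [2^j∸1]+[2^j∸1]≤2^[1+j]∸1 j = ≡.subst (λ z → (2 ^ j ∸ 1) + (2 ^ j ∸ 1) ≤ z ∸ 1) (≡.sym (2^-suc j)) (half (2 ^ j) (1≤2^ j))
    where
    half : ∀ w → 1 ≤ w → (w ∸ 1) + (w ∸ 1) ≤ (w + w) ∸ 1
    half (suc w) _ = ℕ.+-monoʳ-≤ w (ℕ.n≤1+n w)

  with-lower-bound : ∀ {lo lo′ hi is} → All (lo′ ≤_) is → All (λ i → lo ≤ i × i ≤ hi) is → All (λ i → lo′ ≤ i × i ≤ hi) is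
  with-lower-bound lo′≤is bounds = All.zipWith (λ (lo′≤i , (_ , i≤hi)) → lo′≤i , i≤hi) (lo′≤is , bounds)

  -- deg a_i = 2 ^ (i - 1) for i ≥ 1
  degSum : List ℕ → ℕ
  degSum is = sum (map (λ i → 2 ^ (i ∸ 1)) is)

  degSum-bound : ∀ {lo hi} is → AllPairs _<_ is → All (λ i → suc lo ≤ i × i ≤ hi) is → lo ≤ hi →
    degSum is + 2 ^ lo ≤ 2 ^ hi
  degSum-bound []       _                  _                          lo≤hi = ℕ.^-monoʳ-≤ 2 lo≤hi
  degSum-bound {lo} {hi} (suc i ∷ rest) (i<rest ∷ increasing) ((lo<i , i≤hi) ∷ bounds) _ = begin
    2 ^ i + degSum rest + 2 ^ lo
      ≤⟨ ℕ.+-monoʳ-≤ (2 ^ i + degSum rest) (ℕ.^-monoʳ-≤ 2 (ℕ.≤-pred lo<i)) ⟩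
    2 ^ i + degSum rest + 2 ^ i
      ≡⟨ ℕ.+-comm (2 ^ i + degSum rest) (2 ^ i) ⟩
    2 ^ i + (2 ^ i + degSum rest)
      ≡⟨ ℕ.+-assoc (2 ^ i) (2 ^ i) (degSum rest) ⟨
    2 ^ i + 2 ^ i + degSum rest
      ≡⟨ ≡.cong (_+ degSum rest) (2^-suc i) ⟨
    2 ^ suc i + degSum rest
      ≡⟨ ℕ.+-comm (2 ^ suc i) (degSum rest) ⟩
    degSum rest + 2 ^ suc i
      ≤⟨ degSum-bound rest increasing (with-lower-bound i<rest bounds) i≤hi ⟩
    2 ^ hi  ∎

  degSum-bound-with-gap : ∀ {lo hi j} is → AllPairs _<_ is → All (λ i → suc lo ≤ i × i ≤ hi) is →
    suc lo ≤ j → j ≤ hi → j ∉ is → degSum is + 2 ^ suc lo ≤ 2 ^ hi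
  degSum-bound-with-gap [] _ _ lo<j j≤hi _ = ℕ.^-monoʳ-≤ 2 (ℕ.≤-trans lo<j j≤hi)
  degSum-bound-with-gap {lo} {hi} {j} (suc i ∷ rest) (i<rest ∷ increasing) ((lo<i , i≤hi) ∷ bounds) lo<j j≤hi j∉is
    with ℕ.<-cmp j (suc i)
  ... | tri≈ _ j≡i _ = ⊥-elim (j∉is (here j≡i))
  ... | tri< j<i _ _ = begin
    degSum (suc i ∷ rest) + 2 ^ suc lo
      ≤⟨ ℕ.+-monoʳ-≤ (degSum (suc i ∷ rest)) (ℕ.^-monoʳ-≤ 2 (ℕ.≤-pred (ℕ.≤-trans (s≤s lo<j) j<i))) ⟩
    degSum (suc i ∷ rest) + 2 ^ i
      ≤⟨ degSum-bound (suc i ∷ rest) (i<rest ∷ increasing) ((ℕ.≤-refl , i≤hi) ∷ with-lower-bound (All.map ℕ.<⇒≤ i<rest) bounds)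
                     (ℕ.≤-trans (ℕ.n≤1+n i) i≤hi) ⟩
    2 ^ hi  ∎
  ... | tri> _ _ i<j = begin
    2 ^ i + degSum rest + 2 ^ suc lo
      ≡⟨ ℕ.+-assoc (2 ^ i) (degSum rest) (2 ^ suc lo) ⟩
    2 ^ i + (degSum rest + 2 ^ suc lo)
      ≡⟨ ≡.cong (λ x → 2 ^ i + x) (ℕ.+-comm (degSum rest) (2 ^ suc lo)) ⟩
    2 ^ i + (2 ^ suc lo + degSum rest)
      ≡⟨ ℕ.+-assoc (2 ^ i) (2 ^ suc lo) (degSum rest) ⟨
    2 ^ i + 2 ^ suc lo + degSum rest
      ≤⟨ ℕ.+-monoˡ-≤ (degSum rest) (ℕ.+-mono-≤ (ℕ.^-monoʳ-≤ 2 (ℕ.n≤1+n i)) (ℕ.^-monoʳ-≤ 2 lo<i)) ⟩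
    2 ^ suc i + 2 ^ suc i + degSum rest
      ≡⟨ ≡.cong (_+ degSum rest) (2^-suc (suc i)) ⟨
    2 ^ suc (suc i) + degSum rest
      ≡⟨ ℕ.+-comm (2 ^ suc (suc i)) (degSum rest) ⟩
    degSum rest + 2 ^ suc (suc i)
      ≤⟨ degSum-bound-with-gap rest increasing (with-lower-bound i<rest bounds) i<j j≤hi (j∉is ∘ there) ⟩
    2 ^ hi  ∎

  degSum-∷ʳ : ∀ is i → degSum (is ∷ʳ i) ≡ degSum is + 2 ^ (i ∸ 1)
  degSum-∷ʳ is i = begin-equality
    sum (map _ (is ∷ʳ i))               ≡⟨ ≡.cong sum (map-++ _ is (i ∷ [])) ⟩
    sum (map _ is ++ 2 ^ (i ∸ 1) ∷ [])  ≡⟨ sum-++ (map _ is) (2 ^ (i ∸ 1) ∷ []) ⟩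
    degSum is + (2 ^ (i ∸ 1) + 0)       ≡⟨ ≡.cong (λ x → degSum is + x) (ℕ.+-identityʳ _) ⟩
    degSum is + 2 ^ (i ∸ 1)             ∎

  last-is-max : ∀ is {t} → AllPairs _<_ (is ∷ʳ t) → All (_≤ t) (is ∷ʳ t)
  last-is-max []       _                      = ℕ.≤-refl ∷ []
  last-is-max (i ∷ is) (i<is∷ʳt ∷ increasing) = ℕ.<⇒≤ (proj₂ (∷ʳ⁻ i<is∷ʳt)) ∷ last-is-max is increasing

  2+[k+S]≤S+2^lo : ∀ {k lo} S → k + 2 ≤ 2 ^ lo → 2 + (k + S) ≤ S + 2 ^ lo
  2+[k+S]≤S+2^lo {k} {lo} S k+2≤ = begin
    2 + (k + S)  ≡⟨ ℕ.+-assoc 2 k S ⟨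
    2 + k + S    ≡⟨ ≡.cong (_+ S) (ℕ.+-comm 2 k) ⟩
    k + 2 + S    ≤⟨ ℕ.+-monoˡ-≤ S k+2≤ ⟩
    2 ^ lo + S   ≡⟨ ℕ.+-comm (2 ^ lo) S ⟩
    S + 2 ^ lo   ∎

  1+[k+S]≤2^T∸2^lo : ∀ {k lo S T} → k + 2 ≤ 2 ^ lo → S + 2 ^ suc lo ≤ 2 ^ T → suc (k + S) ≤ 2 ^ T ∸ 2 ^ lo
  1+[k+S]≤2^T∸2^lo {k} {lo} {S} {T} k+2≤ S+2^[1+lo]≤ = ℕ.m+n≤o⇒m≤o∸n (suc (k + S)) (begin
    suc (k + S) + 2 ^ lo   ≤⟨ ℕ.+-monoˡ-≤ (2 ^ lo) (ℕ.n≤1+n _) ⟩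
    2 + (k + S) + 2 ^ lo   ≤⟨ ℕ.+-monoˡ-≤ (2 ^ lo) (2+[k+S]≤S+2^lo {k} {lo} S k+2≤) ⟩
    S + 2 ^ lo + 2 ^ lo    ≡⟨ ℕ.+-assoc S (2 ^ lo) (2 ^ lo) ⟩
    S + (2 ^ lo + 2 ^ lo)  ≡⟨ ≡.cong (λ x → S + x) (2^-suc lo) ⟨
    S + 2 ^ suc lo         ≤⟨ S+2^[1+lo]≤ ⟩
    2 ^ T                  ∎)


module CriticalOrbit {c ℓ} (K : CommutativeRing c ℓ) (isField : IsField K) (infinite : IsInfinite K) where
  open CommutativeRing K
  open PowerSums K isField infinite public
  open DegreeSums

  -- rev-a j = X^(2^j) a_(j+1)(1/X); reversing a_(j+2) = a_(j+1)² + c gives the recursion.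
  rev-a : ℕ → Poly
  rev-a zero    = 1ᴾ
  rev-a (suc j) = rev-a j *ᴾ rev-a j +ᴾ X^ (2 ^ suc j ∸ 1)

  deg-rev-a : ∀ j → deg rev-a j ≤ 2 ^ j ∸ 1
  deg-rev-a zero    = deg-1ᴾ
  deg-rev-a (suc j) = deg-+ᴾ {rev-a j *ᴾ rev-a j} {X^ (2 ^ suc j ∸ 1)}
    (deg-mono {rev-a j *ᴾ rev-a j} ([2^j∸1]+[2^j∸1]≤2^[1+j]∸1 j) (deg-*ᴾ {rev-a j} {rev-a j} (deg-rev-a j) (deg-rev-a j)))
    (deg-X^ _)

  deg-rev-a′ : ∀ j → deg rev-a j ≤ 2 ^ j
  deg-rev-a′ j = deg-mono {rev-a j} (ℕ.m∸n≤m (2 ^ j) 1) (deg-rev-a j)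

  coeff₀-rev-a : ∀ j → coeff (rev-a j) 0 ≈ 1#
  coeff₀-rev-a zero    = refl
  coeff₀-rev-a (suc j) = trans (coeff-+ᴾ (rev-a j *ᴾ rev-a j) (X^ (2 ^ suc j ∸ 1)) 0)
    (trans (+-cong (trans (coeff-*ᴾ-zero (rev-a j) (rev-a j)) (trans (*-cong (coeff₀-rev-a j) (coeff₀-rev-a j)) (*-identityˡ 1#)))
                   (coeff-X^-low 0<2^suc-j∸1))
           (+-identityʳ 1#))
    where
    0<2^suc-j∸1 : 0 < 2 ^ suc j ∸ 1
    0<2^suc-j∸1 = ℕ.m<n⇒0<n∸m (ℕ.^-monoʳ-≤ 2 (s≤s (z≤n {j})))

  rev-a-square : ∀ j → rev-a (suc j) ≈ᴾ rev-a j *ᴾ rev-a j mod-X^ (2 ^ suc j ∸ 1)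
  rev-a-square j = +ᴾ-≈0-mod {rev-a j *ᴾ rev-a j} (X^≈0-mod _)

  evalRev-rev-a : ∀ j x → evalRev (2 ^ j) (rev-a j) x ≈ a K (suc j) x
  evalRev-rev-a zero    x = trans (evalRev-1ᴾ 1 x) (trans (*-identityʳ x) (sym (trans (+-congʳ (zeroˡ 0#)) (+-identityˡ x))))
  evalRev-rev-a (suc j) x = begin
    evalRev (2 ^ suc j) (rev-a j *ᴾ rev-a j +ᴾ X^ n) x                  ≈⟨ evalRev-+ᴾ (rev-a j *ᴾ rev-a j) (X^ n) (2 ^ suc j) x ⟩
    evalRev (2 ^ suc j) (rev-a j *ᴾ rev-a j) x + evalRev (2 ^ suc j) (X^ n) x
      ≈⟨ +-cong (reflexive (≡.cong (λ d → evalRev d (rev-a j *ᴾ rev-a j) x) (2^-suc j)))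
                (reflexive (≡.cong (λ d → evalRev d (X^ n) x) (≡.sym (ℕ.suc-pred (2 ^ suc j) {{ℕ.m^n≢0 2 (suc j)}})))) ⟩
    evalRev (2 ^ j ℕ.+ 2 ^ j) (rev-a j *ᴾ rev-a j) x + evalRev (suc n) (X^ n) x
      ≈⟨ +-cong (evalRev-*ᴾ {rev-a j} {rev-a j} x (deg-rev-a′ j) (deg-rev-a′ j)) (evalRev-X^-suc n x) ⟩
    evalRev (2 ^ j) (rev-a j) x * evalRev (2 ^ j) (rev-a j) x + x      ≈⟨ +-congʳ (*-cong (evalRev-rev-a j x) (evalRev-rev-a j x)) ⟩
    a K (suc j) x * a K (suc j) x + x                                 ∎
    where
    open K-Reasoning
    n = 2 ^ suc j ∸ 1

  -- The reversal of a_(T+1) + a_(b+1), of degree 2^T.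
  rev-g : ℕ → ℕ → Poly
  rev-g T b = rev-a T +ᴾ X^ (2 ^ T ∸ 2 ^ b) *ᴾ rev-a b

  rev-g≈rev-a : ∀ T b → rev-g T b ≈ᴾ rev-a T mod-X^ (2 ^ T ∸ 2 ^ b)
  rev-g≈rev-a T b = +ᴾ-≈0-mod {rev-a T} (*ᴾ-≈0-mod {X^ (2 ^ T ∸ 2 ^ b)} (rev-a b) (X^≈0-mod _))

  module _ {T b : ℕ} (b<T : b < T) where

    coeff₀-rev-g : coeff (rev-g T b) 0 ≈ 1#
    coeff₀-rev-g = trans (low-coeff-≈ (rev-g≈rev-a T b) 0<u) (coeff₀-rev-a T)
      where
      0<u : 0 < 2 ^ T ∸ 2 ^ b
      0<u = ℕ.m<n⇒0<n∸m (ℕ.^-monoʳ-< 2 (s≤s (s≤s z≤n)) b<T)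

    evalRev-rev-g : ∀ x → evalRev (2 ^ T) (rev-g T b) x ≈ a K (suc T) x + a K (suc b) x
    evalRev-rev-g x = begin
      evalRev (2 ^ T) (rev-g T b) x                              ≈⟨ evalRev-+ᴾ (rev-a T) (X^ u *ᴾ rev-a b) (2 ^ T) x ⟩
      evalRev (2 ^ T) (rev-a T) x + evalRev (2 ^ T) (X^ u *ᴾ rev-a b) x
        ≈⟨ +-cong (evalRev-rev-a T x) (reflexive (≡.cong (λ d → evalRev d (X^ u *ᴾ rev-a b) x) (≡.sym u+2^b≡2^T))) ⟩
      a K (suc T) x + evalRev (u ℕ.+ 2 ^ b) (X^ u *ᴾ rev-a b) x  ≈⟨ +-congˡ (evalRev-*ᴾ {X^ u} {rev-a b} x (deg-X^ u) (deg-rev-a′ b)) ⟩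
      a K (suc T) x + evalRev u (X^ u) x * evalRev (2 ^ b) (rev-a b) x
        ≈⟨ +-congˡ (*-cong (evalRev-X^ u x) (evalRev-rev-a b x)) ⟩
      a K (suc T) x + 1# * a K (suc b) x                         ≈⟨ +-congˡ (*-identityˡ _) ⟩
      a K (suc T) x + a K (suc b) x                              ∎
      where
      open K-Reasoning
      u = 2 ^ T ∸ 2 ^ b
      u+2^b≡2^T : u ℕ.+ 2 ^ b ≡ 2 ^ T
      u+2^b≡2^T = ℕ.m∸n+n≡m (ℕ.^-monoʳ-≤ 2 (ℕ.<⇒≤ b<T))

    ∏linear≈rev-a : ∀ {γs} → IsRootList K (λ x → a K (suc T) x + a K (suc b) x) γs →
      ∏linear γs ≈ᴾ rev-a T mod-X^ (2 ^ T ∸ 2 ^ b)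
    ∏linear≈rev-a {γs} roots =
      ≈mod.trans (≈mod-weaken (ℕ.m≤n⇒m≤1+n (ℕ.m∸n≤m (2 ^ T) (2 ^ b))) ∏linear≈rev-g) (rev-g≈rev-a T b)
      where
      ∏linear≈rev-g : ∏linear γs ≈ᴾ rev-g T b mod-X^ suc (2 ^ T)
      ∏linear≈rev-g = evalRev-injective {∏linear γs} {rev-g T b} {length γs} (coeff₀-∏linear γs) coeff₀-rev-g
        λ x → trans (evalRev-∏linear γs x) (trans (sym (roots x)) (sym (evalRev-rev-g x)))


module Descent {c ℓ} (K : CommutativeRing c ℓ) (isField : IsField K) (infinite : IsInfinite K) where
  open CommutativeRing K
  open CriticalOrbit K isField infinite public
  open import Algebra.Properties.Semiring.Mult ℙ.semiring using (×-homo-+)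

  factor-θ-square : ∀ N ν w →
    N *ᴾ (w *ᴾ w) +ᴾ -ᴾ (ν *ᴾ θ (w *ᴾ w)) ≈ᴾ w *ᴾ (N *ᴾ w +ᴾ -ᴾ ((ν +ᴾ ν) *ᴾ θ w))
  factor-θ-square N ν w = begin
    N *ᴾ (w *ᴾ w) +ᴾ -ᴾ (ν *ᴾ θ (w *ᴾ w))
      ≈⟨ ℙ.+-congˡ {N *ᴾ (w *ᴾ w)} (ℙ.-‿cong (ℙ.*-congˡ {ν} (θ-*ᴾ w w))) ⟩
    N *ᴾ (w *ᴾ w) +ᴾ -ᴾ (ν *ᴾ (θ w *ᴾ w +ᴾ w *ᴾ θ w))
      ≈⟨ solveᴾ 4 (λ N ν w θw → N :*ᴾ (w :*ᴾ w) :-ᴾ ν :*ᴾ (θw :*ᴾ w :+ᴾ w :*ᴾ θw)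
                               :=ᴾ w :*ᴾ (N :*ᴾ w :-ᴾ (ν :+ᴾ ν) :*ᴾ θw))
                 ℙ.refl N ν w (θ w) ⟩
    w *ᴾ (N *ᴾ w +ᴾ -ᴾ ((ν +ᴾ ν) *ᴾ θ w))  ∎
    where open ℙ-Reasoning

  module _ (E : Poly) (L d : ℕ) where

    -- For w = ∏ (1 - γX)^(1/n) this is the Newton identity for E = Σ 1/(1 - γX), up to X^d.
    Newton : ℕ → Poly → Set ℓ
    Newton n w = w *ᴾ E ≈ᴾ L ·ᴾ 1ᴾ *ᴾ w +ᴾ -ᴾ (n ·ᴾ 1ᴾ *ᴾ θ w) mod-X^ suc d

    newton-halve : ∀ {n w w′} → coeff w 0 ≈ 1# → w′ ≈ᴾ w *ᴾ w mod-X^ suc d → Newton n w′ → Newton (n ℕ.+ n) w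
    newton-halve {n} {w} {w′} w₀≈1 w′≈w² newton-w′ = *ᴾ-cancelˡ-mod w w₀≈1 (begin
      w *ᴾ (w *ᴾ E)
        ≈⟨ ≈ᴾ⇒≈mod (ℙ.sym (ℙ.*-assoc w w E)) ⟩
      (w *ᴾ w) *ᴾ E
        ≈⟨ *ᴾ-congʳ-mod E (≈mod.sym w′≈w²) ⟩
      w′ *ᴾ E
        ≈⟨ newton-w′ ⟩
      N *ᴾ w′ +ᴾ -ᴾ (ν *ᴾ θ w′)
        ≈⟨ +ᴾ-cong-mod (*ᴾ-congˡ-mod N w′≈w²) (-ᴾ-cong-mod (*ᴾ-congˡ-mod ν (θ-cong-mod w′≈w²))) ⟩
      N *ᴾ (w *ᴾ w) +ᴾ -ᴾ (ν *ᴾ θ (w *ᴾ w))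
        ≈⟨ ≈ᴾ⇒≈mod (factor-θ-square N ν w) ⟩
      w *ᴾ (N *ᴾ w +ᴾ -ᴾ ((ν +ᴾ ν) *ᴾ θ w))
        ≈⟨ ≈ᴾ⇒≈mod (ℙ.*-congˡ {w} (ℙ.+-congˡ {N *ᴾ w} (ℙ.-‿cong (ℙ.*-congʳ {θ w} (×-homo-+ 1ᴾ n n))))) ⟨
      w *ᴾ (N *ᴾ w +ᴾ -ᴾ (2ν *ᴾ θ w))  ∎)
      where
      open mod-Reasoning (suc d)
      N  = L ·ᴾ 1ᴾ
      ν  = n ·ᴾ 1ᴾ
      2ν = (n ℕ.+ n) ·ᴾ 1ᴾ

    newton-descend : ∀ {t T n} → t ≤ T → 2 ℕ.+ d ≤ 2 ^ suc t → Newton n (rev-a T) → ∃ λ n′ → Newton n′ (rev-a t)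
    newton-descend {t} {T} {n} t≤T bound = go {T} {n} (ℕ.≤⇒≤′ t≤T)
      where
      go : ∀ {T n} → t ℕ.≤′ T → Newton n (rev-a T) → ∃ λ n′ → Newton n′ (rev-a t)
      go {n = n} ℕ.≤′-refl              newton-T = n , newton-T
      go {n = n} (ℕ.≤′-step {T} t≤′T) newton-T =
        go {T} {n ℕ.+ n} t≤′T (newton-halve {n} (coeff₀-rev-a T) (≈mod-weaken 1+d≤2^[1+T]-1 (rev-a-square T)) newton-T)
        where
        1+d≤2^[1+T]-1 : suc d ≤ 2 ^ suc T ∸ 1
        1+d≤2^[1+T]-1 = ℕ.pred-mono-≤ (ℕ.≤-trans bound (ℕ.^-monoʳ-≤ 2 (s≤s (ℕ.≤′⇒≤ t≤′T))))

    newton-coeff≈0 : ∀ {n w V e f} → Newton n w → deg w ≤ e → deg V ≤ f → f ℕ.+ e < d →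
      coeff (V *ᴾ w *ᴾ E) d ≈ 0#
    newton-coeff≈0 {n} {w} {V} {e} {f} newton-w w≤e V≤f f+e<d = begin
      coeff (V *ᴾ w *ᴾ E) d       ≈⟨ coeff-≈ (ℙ.*-assoc V w E) d ⟩
      coeff (V *ᴾ (w *ᴾ E)) d     ≈⟨ low-coeff-≈ (*ᴾ-congˡ-mod V newton-w) ℕ.≤-refl ⟩
      coeff (V *ᴾ R) d            ≈⟨ deg-*ᴾ {V} {R} V≤f R≤e d f+e<d ⟩
      0#                          ∎
      where
      open K-Reasoning
      R = L ·ᴾ 1ᴾ *ᴾ w +ᴾ -ᴾ (n ·ᴾ 1ᴾ *ᴾ θ w)
      R≤e : deg R ≤ e
      R≤e = deg-+ᴾ {L ·ᴾ 1ᴾ *ᴾ w} (deg-*ᴾ {L ·ᴾ 1ᴾ} {w} (deg-·ᴾ1ᴾ L) w≤e)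
                   (deg--ᴾ {n ·ᴾ 1ᴾ *ᴾ θ w} (deg-*ᴾ {n ·ᴾ 1ᴾ} {θ w} (deg-·ᴾ1ᴾ n) (deg-θ {w} w≤e)))

  newton-∏linear : ∀ {γs d w} → ∏linear γs ≈ᴾ w mod-X^ suc d → Newton (Σgeometric γs d) (length γs) d 1 w
  newton-∏linear {γs} {d} {w} Π≈w = begin
    w *ᴾ E                         ≈⟨ *ᴾ-congʳ-mod E (≈mod.sym Π≈w) ⟩
    Π *ᴾ E                         ≈⟨ newton-identity γs d ⟩
    N *ᴾ Π +ᴾ -ᴾ θ Π               ≈⟨ +ᴾ-cong-mod (*ᴾ-congˡ-mod N Π≈w) (-ᴾ-cong-mod (θ-cong-mod Π≈w)) ⟩
    N *ᴾ w +ᴾ -ᴾ θ w               ≈⟨ ≈ᴾ⇒≈mod (ℙ.+-congˡ {N *ᴾ w} (ℙ.-‿cong 1·θw≈θw)) ⟨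
    N *ᴾ w +ᴾ -ᴾ (1 ·ᴾ 1ᴾ *ᴾ θ w)  ∎
    where
    open mod-Reasoning (suc d)
    Π = ∏linear γs
    E = Σgeometric γs d
    N = length γs ·ᴾ 1ᴾ
    1·θw≈θw : 1 ·ᴾ 1ᴾ *ᴾ θ w ≈ᴾ θ w
    1·θw≈θw = ℙ.trans (ℙ.*-congʳ {θ w} (ℙ.+-identityʳ 1ᴾ)) (ℙ.*-identityˡ (θ w))


module CriticalPowerSums {c ℓ} (K : CommutativeRing c ℓ) (isField : IsField K) (infinite : IsInfinite K) where
  open CommutativeRing K
  open Descent K isField infinite public
  open DegreeSums
  open import Data.List.Relation.Unary.All using (All; []; _∷_)
  open import Data.List.Relation.Unary.All.Properties using (∷ʳ⁺)

  rev-∏a : List ℕ → Poly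
  rev-∏a []       = 1ᴾ
  rev-∏a (i ∷ is) = rev-a (i ∸ 1) *ᴾ rev-∏a is

  deg-rev-∏a : ∀ is → deg rev-∏a is ≤ degSum is
  deg-rev-∏a []       = deg-1ᴾ
  deg-rev-∏a (i ∷ is) = deg-*ᴾ {rev-a (i ∸ 1)} {rev-∏a is} (deg-rev-a′ (i ∸ 1)) (deg-rev-∏a is)

  evalRev-rev-∏a : ∀ {is} x → All (1 ≤_) is → evalRev (degSum is) (rev-∏a is) x ≈ prodL K (mapL K (λ i → a K i x) is)
  evalRev-rev-∏a {[]}         x []        = evalRev-1ᴾ 0 x
  evalRev-rev-∏a {suc i ∷ is} x (_ ∷ pos) =
    trans (evalRev-*ᴾ {rev-a i} {rev-∏a is} x (deg-rev-a′ i) (deg-rev-∏a is)) (*-cong (evalRev-rev-a i x) (evalRev-rev-∏a x pos))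

  rev-∏a-∷ʳ : ∀ is i → rev-∏a (is ∷ʳ i) ≈ᴾ rev-∏a is *ᴾ rev-a (i ∸ 1)
  rev-∏a-∷ʳ []       i = ℙ.trans (ℙ.*-identityʳ _) (ℙ.sym (ℙ.*-identityˡ _))
  rev-∏a-∷ʳ (j ∷ is) i =
    ℙ.trans (ℙ.*-congˡ {rev-a (j ∸ 1)} (rev-∏a-∷ʳ is i)) (ℙ.sym (ℙ.*-assoc (rev-a (j ∸ 1)) (rev-∏a is) (rev-a (i ∸ 1))))

  Tsum-vanishes : ∀ {T b γs} → b < T → IsRootList K (λ x → a K (suc T) x + a K (suc b) x) γs →
    ∀ k is t → All (1 ≤_) is → t ≤ T →
    suc (k ℕ.+ degSum (is ∷ʳ suc t)) ≤ 2 ^ T ∸ 2 ^ b → 2 ℕ.+ (k ℕ.+ degSum (is ∷ʳ suc t)) ≤ 2 ^ suc t →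
    Tsum K (λ x → pow K x k * prodL K (mapL K (λ i → a K i x) (is ∷ʳ suc t))) γs ≈ 0#
  Tsum-vanishes {T} {b} {γs} b<T roots k is t pos t≤T d<2^T-2^b 2+d≤2^[1+t] = begin
    Tsum K f γs
      ≈⟨ sum≈coeff-*ᴾ-Σgeometric {f} {ρ} {d} f≈evalRev-ρ γs ⟩
    coeff (ρ *ᴾ E) d
      ≈⟨ coeff-≈ (ℙ.*-congʳ {E} ρ≈V*rev-a) d ⟩
    coeff (V *ᴾ rev-a t *ᴾ E) d
      ≈⟨ newton-coeff≈0 E (length γs) d {proj₁ descended} {rev-a t} {V} (proj₂ descended) (deg-rev-a t) deg-V deg-V+deg-rev-a<d ⟩
    0#  ∎
    where
    open K-Reasoning
    js = is ∷ʳ suc t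
    d  = k ℕ.+ degSum js
    E  = Σgeometric γs d
    f : Carrier → Carrier
    f x = pow K x k * prodL K (mapL K (λ i → a K i x) js)
    ρ  = 1ᴾ *ᴾ rev-∏a js
    V  = 1ᴾ *ᴾ rev-∏a is

    f≈evalRev-ρ : ∀ x → f x ≈ evalRev d ρ x
    f≈evalRev-ρ x = sym (trans (evalRev-*ᴾ {1ᴾ} {rev-∏a js} {k} x (deg-mono {1ᴾ} z≤n deg-1ᴾ) (deg-rev-∏a js))
                               (*-cong (evalRev-1ᴾ k x) (evalRev-rev-∏a x (∷ʳ⁺ pos (s≤s z≤n)))))

    ρ≈V*rev-a : ρ ≈ᴾ V *ᴾ rev-a t
    ρ≈V*rev-a = ℙ.trans (ℙ.*-congˡ {1ᴾ} (rev-∏a-∷ʳ is (suc t))) (ℙ.sym (ℙ.*-assoc 1ᴾ (rev-∏a is) (rev-a t)))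

    descended : ∃ λ n → Newton E (length γs) d n (rev-a t)
    descended = newton-descend E (length γs) d {n = 1} t≤T 2+d≤2^[1+t]
                  (newton-∏linear {γs} (≈mod-weaken d<2^T-2^b (∏linear≈rev-a b<T {γs} roots)))

    deg-V : deg V ≤ k ℕ.+ degSum is
    deg-V = deg-*ᴾ {1ᴾ} {rev-∏a is} {k} (deg-mono {1ᴾ} z≤n deg-1ᴾ) (deg-rev-∏a is)

    deg-V+deg-rev-a<d : k ℕ.+ degSum is ℕ.+ (2 ^ t ∸ 1) < d
    deg-V+deg-rev-a<d = ≡.subst (k ℕ.+ degSum is ℕ.+ (2 ^ t ∸ 1) <_)
      (≡.trans (ℕ.+-assoc k (degSum is) (2 ^ t)) (≡.cong (k ℕ.+_) (≡.sym (degSum-∷ʳ is (suc t)))))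
      (ℕ.+-monoʳ-< (k ℕ.+ degSum is) (ℕ.∸-monoʳ-< (s≤s (z≤n {0})) (1≤2^ t)))


-- Imported only here, since in the modules above _+_ is the addition of K.
open import Data.Nat using (_+_)

lemma3p6 : ∀ {c ℓ} (K : CommutativeRing c ℓ) → IsField K → IsInfinite K →
  (m n : ℕ) → 2 ≤ m → 1 ≤ n →
  (is : List ℕ) → is ≢ [] → Linked _<_ is →
  All (λ i → (m ∸ 1 ≤ i) × (i ≤ m + n ∸ 2)) is →
  (∃ λ j → (m ∸ 1 ≤ j) × (j ≤ m + n ∸ 2) × (j ∉ is)) →
  (k : ℕ) → k + 2 ≤ 2 ^ (m ∸ 2) →
  (γs : List (CommutativeRing.Carrier K)) →
  IsRootList K (λ x → CommutativeRing._+_ K (a K (m + n ∸ 1) x) (a K (m ∸ 1) x)) γs →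
  CommutativeRing._≈_ K
    (Tsum K (λ x → CommutativeRing._*_ K (pow K x k) (prodL K (mapL K (λ i → a K i x) is))) γs)
    (CommutativeRing.0# K)
lemma3p6 K isField infinite (suc (suc m)) (suc n) (s≤s (s≤s z≤n)) (s≤s z≤n) is is≢[] increasing bounds (j , m<j , j≤T , j∉is) k k+2≤2^m γs roots
  with initLast is
... | []            = ⊥-elim (is≢[] ≡.refl)
... | init ∷ʳ′ zero = ⊥-elim (ℕ.n≮0 (proj₁ (proj₂ (∷ʳ⁻ bounds))))
... | init ∷ʳ′ suc t =
  Tsum-vanishes {γs = γs} (ℕ.m<m+n m (s≤s z≤n)) roots k init t init-positive t≤T d<2^T∸2^m 2+d≤2^[1+t]
  where
  open CriticalPowerSums K isField infinite
  open DegreeSums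
  pairs = Linked⇒AllPairs ℕ.<-trans increasing
  init-bounds = proj₁ (∷ʳ⁻ bounds)
  m<1+t = proj₁ (proj₂ (∷ʳ⁻ bounds))
  1+t≤T = proj₂ (proj₂ (∷ʳ⁻ bounds))

  init-positive : All (1 ≤_) init
  init-positive = All.map (λ (m<i , _) → ℕ.≤-trans (s≤s z≤n) m<i) init-bounds

  t≤T : t ≤ m + suc n
  t≤T = ℕ.≤-trans (ℕ.n≤1+n t) 1+t≤T

  d<2^T∸2^m : suc (k + degSum (init ∷ʳ suc t)) ≤ 2 ^ (m + suc n) ∸ 2 ^ m
  d<2^T∸2^m = 1+[k+S]≤2^T∸2^lo {k} {m} {T = m + suc n} k+2≤2^m (degSum-bound-with-gap (init ∷ʳ suc t) pairs bounds m<j j≤T j∉is)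

  2+d≤2^[1+t] : 2 + (k + degSum (init ∷ʳ suc t)) ≤ 2 ^ suc t
  2+d≤2^[1+t] = ℕ.≤-trans (2+[k+S]≤S+2^lo {k} {m} (degSum (init ∷ʳ suc t)) k+2≤2^m)
    (degSum-bound (init ∷ʳ suc t) pairs (All.zipWith (λ ((m<i , _) , i≤t) → m<i , i≤t) (bounds , last-is-max init pairs))
                  (ℕ.≤-trans (ℕ.n≤1+n m) m<1+t))
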